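{- If $H$ is a history sequence of the Simpler Lazy Set algorithm, then the structure $M_H$ satisfies the Lazy Set axioms A0, A1 and A2.
   Context: Simpler Lazy Set algorithm. Fix an infinite set $A$ of addresses with distinguished $\mathsf H,\mathsf T$, and finitely many processes. A state $S$: finite $\mathrm{Active}^S\subseteq A$ containing $\mathsf H,\mathsf T$; $\mathrm{Val}^S:\mathrm{Active}^S\to\mathbb N\cup\{ -1,\infty\}$ with $\mathrm{Val}(\mathsf H)=-1,\mathrm{Val}(\mathsf T)=\infty$, natural values otherwise; $\mathrm{Next}^S:\mathrm{Active}^S\setminus\{\mathsf T\}\to A$; for each process $p$: $PC_p\in\{0,1,2,3.1,\dots,3.5\}$, $x_p\in\mathbb N$, an address variable $\mathrm{curr}_p$. $S$ is normal if $\mathrm{Next}$ maps active addresses to active ones with $\mathrm{Val}(a)<\mathrm{Val}(\mathrm{Next}(a))$; the path $\mathsf H,\mathrm{Next}(\mathsf H),\dots,\mathsf T$ is the main branch. Initial state: $\mathrm{Active}=\{\mathsf H,\mathsf T\}$, $\mathrm{Next}(\mathsf H)=\mathsf T$, all $PC_p=0$. Steps $(S,e,T)$ by $p$ (unmentioned items unchanged): invocation $PC_p:0\to1,2$ or $3.1$, $x_p$ set arbitrarily; failed action: $PC_p:1\to0$ (an AD action) or $2\to0$ (an RM action) with status $\chi(e)=f$; $\mathrm{AD}(x)$, $x=x_p$, $PC_p:1\to0$: let $u$ on the main branch satisfy $\mathrm{Val}(u)<x\le\mathrm{Val}(\mathrm{Next}(u))$; if $\mathrm{Val}(\mathrm{Next}(u))=x$: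 no change, $\chi(e)=1$, $\mathrm{adr}(e)=\mathrm{Next}(u)$; else a new $a\notin\mathrm{Active}^S$ becomes active, $\mathrm{Val}(a)=x$, $\mathrm{Next}^T(u)=a$, $\mathrm{Next}^T(a)=\mathrm{Next}^S(u)$, $\chi(e)=0$, $\mathrm{adr}(e)=a$ ($e$ activates $a$); $\mathrm{RM}(x)$, $PC_p:2\to0$: if a main-branch $d$ has $\mathrm{Val}(d)=x$, with main-branch predecessor $c$, set $\mathrm{Next}^T(c)=\mathrm{Next}^S(d)$, $\chi(e)=1$, $\mathrm{adr}(e)=d$; else no change, $\chi(e)=0$; $\mathrm{CONTAINS}(x_p)$: line 3.1 sets $\mathrm{curr}_p:=\mathsf H$; then repeatedly $\mathrm{curr}_p:=\mathrm{Next}(\mathrm{curr}_p)$ until $\mathrm{Val}(\mathrm{curr}_p)\ge x_p$; then return (line 3.5, $PC_p\to0$) status $1$ if $\mathrm{Val}(\mathrm{curr}_p)=x_p$ and $0$ otherwise. A history is a sequence $S_0,e_0,S_1,e_1,\dots$ with $S_0$ initial and each $(S_i,e_i,S_{i+1})$ a step. For an address $a\ne\mathsf H,\mathsf T$ active in some $S_j$, $\mathrm{activation}(a)$ is the unique AD action with status $0$ that activates $a$. Structure $M_H$: low-level events are the actions $e_i$, ordered $e_i<e_j$ iff $i<j$; high-level events are the complete CONTAINS executions $E$ (the actions of one process from its execution of line 3.1 to the following return at 3.5), with $\mathrm{Begin}(E),\mathrm{End}(E)$ its first and last actions; $\mathrm{Begin}(e)=\mathrm{End}(e)=e$ for actions;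 $X<Y$ iff $\mathrm{End}(X)<\mathrm{Begin}(Y)$. $\mathrm{Add}$ = AD actions, $\mathrm{Rem}$ = RM actions, $\mathrm{Cnt}$ = CONTAINS executions; $\mathrm{val}$ = the parameter $x$; $\chi$ = the status. $\gamma$: for an AD or RM action $e$ with $\chi(e)=1$, $\gamma(e)=\mathrm{activation}(\mathrm{adr}(e))$; for a CONTAINS execution $E$ with $\chi(E)=1$, $\gamma(E)=\mathrm{activation}(a)$ where $a$ is the value of $\mathrm{curr}_p$ at the return. Shorthands: $\mathrm{Add}^p(a):\equiv\mathrm{Add}(a)\wedge\chi(a)=p$, similarly $\mathrm{Rem}^p,\mathrm{Cnt}^p$; $\mathrm{Op}^p(a):\equiv(\mathrm{Add}\vee\mathrm{Rem}\vee\mathrm{Cnt})(a)\wedge\chi(a)=p$, $p\in\{0,1\}$. Axioms: A0: $\mathrm{Add},\mathrm{Rem},\mathrm{Cnt}$ pairwise disjoint; Add/Rem events low-level, Cnt events high-level; $\mathrm{Begin},\mathrm{End}$ always low-level; $\mathrm{Begin}(E)=\mathrm{End}(E)=E$ for Add/Rem, $\mathrm{Begin}(E)<\mathrm{End}(E)$ for Cnt; $<$ linear on low-level events. A1: for every $A$ with $\mathrm{Op}^1(A)$: $\mathrm{Add}^0(\gamma(A))$, $\mathrm{val}(\gamma(A))=\mathrm{val}(A)$, $\gamma(A)<\mathrm{End}(A)$, and no $R$ has $\mathrm{Rem}^1(R)$, $\gamma(R)=\gamma(A)$, $\gamma(A)<R<A$. A2: for all $A,B$ with $\mathrm{Op}^0(B)$,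 $\mathrm{Add}^0(A)$, $A<B$, $\mathrm{val}(A)=\mathrm{val}(B)$ there is $R$ with $\mathrm{Rem}^1(R)$, $A=\gamma(R)$, $R<\mathrm{End}(B)$. -}

module Defs where

open import Data.Nat using (ℕ; zero; suc; _<_; _≤_)
open import Data.Nat.Properties using (<-≤-trans; <⇒≤)
open import Data.Fin using (Fin; _≟_)
open import Data.Bool using (Bool; true; false)
open import Data.List using (List)
open import Data.List.Membership.Propositional using (_∈_)
open import Data.Product using (Σ; _×_; _,_; proj₁; proj₂)
open import Data.Sum using (_⊎_; inj₁; inj₂)
open import Data.Unit using (⊤; tt)
open import Data.Empty using (⊥)
open import Function.Definitions using (Injective)
open import Relation.Nullary using (¬_; yes; no)
open import Relation.Binary.PropositionalEquality using (_≡_; _≢_; refl)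

data Status : Set where
  s0 s1 sf : Status

record Structure : Set₁ where
  field
    Event       : Set
    Low         : Event → Set
    Begin End   : Event → Event
    _≺_         : Event → Event → Set
    Add Rem Cnt : Event → Set
    val         : Event → ℕ
    χ           : Event → Status
    γ           : Event → Event

module _ (M : Structure) where
  open Structure M

  Op : Status → Event → Set
  Op p a = (Add a ⊎ Rem a ⊎ Cnt a) × χ a ≡ p

  A0 : Set
  A0 =
    ((a : Event) → ¬ (Add a × Rem a)) ×
    ((a : Event) → ¬ (Add a × Cnt a)) ×
    ((a : Event) → ¬ (Rem a × Cnt a)) ×
    ((a : Event) → Add a → Low a) ×
    ((a : Event) → Rem a → Low a) ×
    ((a : Event) → Cnt a → ¬ Low a) ×
    ((a : Event) → Low (Begin a) × Low (End a)) ×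
    ((a : Event) → Add a ⊎ Rem a → Begin a ≡ a × End a ≡ a) ×
    ((a : Event) → Cnt a → Begin a ≺ End a) ×
    ((a : Event) → Low a → ¬ (a ≺ a)) ×
    ((a b c : Event) → Low a → Low b → Low c → a ≺ b → b ≺ c → a ≺ c) ×
    ((a b : Event) → Low a → Low b → a ≺ b ⊎ a ≡ b ⊎ b ≺ a)

  A1 : Set
  A1 = (a : Event) → Op s1 a →
         Add (γ a) × χ (γ a) ≡ s0 ×
         val (γ a) ≡ val a ×
         γ a ≺ End a ×
         ¬ (Σ Event λ r → Rem r × χ r ≡ s1 × γ r ≡ γ a × γ a ≺ r × r ≺ a)

  A2 : Set
  A2 = (a b : Event) → Op s0 b → Add a → χ a ≡ s0 → a ≺ b → val a ≡ val b →
         Σ Event λ r → Rem r × χ r ≡ s1 × a ≡ γ r × r ≺ End b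

-- The Simpler Lazy Set algorithm

record Setting : Set₁ where
  field
    Addr     : Set
    Hd Tl    : Addr
    Hd≢Tl    : Hd ≢ Tl
    enum     : ℕ → Addr
    enum-inj : Injective _≡_ _≡_ enum     -- A is infinite
    nproc    : ℕ

data V : Set where
  neg1 : V
  nat  : ℕ → V
  inf  : V

data _<ᵛ_ : V → V → Set where
  neg1<nat : ∀ {n} → neg1 <ᵛ nat n
  neg1<inf : neg1 <ᵛ inf
  nat<nat  : ∀ {m n} → m < n → nat m <ᵛ nat n
  nat<inf  : ∀ {n} → nat n <ᵛ inf

_≤ᵛ_ : V → V → Set
v ≤ᵛ w = v <ᵛ w ⊎ v ≡ w

data PCv : Set where
  pc0 pc1 pc2 pc31 pc32 pc33 pc34 pc35 : PCv

data OpKind : Set where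
  opAdd opRem opCnt : OpKind

invTarget : OpKind → PCv
invTarget opAdd = pc1
invTarget opRem = pc2
invTarget opCnt = pc31

module _ (σ : Setting) where
  open Setting σ

  Proc : Set
  Proc = Fin nproc

  upd : {X : Set} → (Proc → X) → Proc → X → Proc → X
  upd f p v q with q ≟ p
  ... | yes _ = v
  ... | no  _ = f q

  record State : Set where
    field
      Active : Addr → Bool
      Val    : Addr → V
      Next   : Addr → Addr
      PC     : Proc → PCv
      X      : Proc → ℕ
      Curr   : Proc → Addr
  open State public

  IsState : State → Set
  IsState S =
    Active S Hd ≡ true × Active S Tl ≡ true ×
    Val S Hd ≡ neg1 × Val S Tl ≡ inf ×
    ((a : Addr) → Active S a ≡ true → a ≢ Hd → a ≢ Tl → Σ ℕ λ n → Val S a ≡ nat n) ×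
    Σ (List Addr) (λ L → (a : Addr) → Active S a ≡ true → a ∈ L)

  Initial : State → Set
  Initial S =
    ((a : Addr) → Active S a ≡ true → a ≡ Hd ⊎ a ≡ Tl) ×
    Active S Hd ≡ true × Active S Tl ≡ true ×
    Next S Hd ≡ Tl ×
    ((p : Proc) → PC S p ≡ pc0)

  data OnMain (S : State) : Addr → Set where
    mHd   : OnMain S Hd
    mNext : ∀ {u} → OnMain S u → u ≢ Tl → OnMain S (Next S u)

  -- The status and address of an AD/RM action are
  -- determined by the constructor: adFail (f), adNew a (0, activates a),
  -- adFound a (1, adr = a), rmFail (f), rmOk d (1, adr = d), rmNo (0);
  -- c31, c32, c33 are the lines 3.1-3.3 of CONTAINS, retYes/retNo the
  -- return at line 3.5 with status 1/0.
  data Label : Set where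
    inv     : Proc → OpKind → ℕ → Label
    adFail  : Proc → Label
    adNew   : Proc → Addr → Label
    adFound : Proc → Addr → Label
    rmFail  : Proc → Label
    rmOk    : Proc → Addr → Label
    rmNo    : Proc → Label
    c31 c32 c33 : Proc → Label
    retYes retNo : Proc → Label

  procOf : Label → Proc
  procOf (inv p _ _)   = p
  procOf (adFail p)    = p
  procOf (adNew p _)   = p
  procOf (adFound p _) = p
  procOf (rmFail p)    = p
  procOf (rmOk p _)    = p
  procOf (rmNo p)      = p
  procOf (c31 p)       = p
  procOf (c32 p)       = p
  procOf (c33 p)       = p
  procOf (retYes p)    = p
  procOf (retNo p)     = p

  SameHeap : State → State → Set
  SameHeap S T =
    ((a : Addr) → Active T a ≡ Active S a) ×
    ((a : Addr) → Val T a ≡ Val S a) ×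
    ((a : Addr) → Next T a ≡ Next S a)

  Local : State → State → Proc → PCv → ℕ → Addr → Set
  Local S T p pc x c =
    ((q : Proc) → PC T q ≡ upd (PC S) p pc q) ×
    ((q : Proc) → X T q ≡ upd (X S) p x q) ×
    ((q : Proc) → Curr T q ≡ upd (Curr S) p c q)

  SetPC : State → State → Proc → PCv → Set
  SetPC S T p pc = Local S T p pc (X S p) (Curr S p)

  Step : State → Label → State → Set
  Step S (inv p o x) T =
    PC S p ≡ pc0 × SameHeap S T × Local S T p (invTarget o) x (Curr S p)
  Step S (adFail p) T =
    PC S p ≡ pc1 × SameHeap S T × SetPC S T p pc0
  Step S (adFound p a) T =
    PC S p ≡ pc1 ×
    Σ Addr (λ u → OnMain S u ×
      Val S u <ᵛ nat (X S p) × nat (X S p) ≤ᵛ Val S (Next S u) ×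
      Val S (Next S u) ≡ nat (X S p) × a ≡ Next S u) ×
    SameHeap S T × SetPC S T p pc0
  Step S (adNew p a) T =
    PC S p ≡ pc1 ×
    Σ Addr (λ u → OnMain S u ×
      Val S u <ᵛ nat (X S p) × nat (X S p) ≤ᵛ Val S (Next S u) ×
      Val S (Next S u) ≢ nat (X S p) ×
      Active S a ≡ false ×
      (Active T a ≡ true × ((b : Addr) → b ≢ a → Active T b ≡ Active S b)) ×
      (Val T a ≡ nat (X S p) × ((b : Addr) → b ≢ a → Val T b ≡ Val S b)) ×
      (Next T u ≡ a × Next T a ≡ Next S u ×
        ((b : Addr) → b ≢ u → b ≢ a → Next T b ≡ Next S b))) ×
    SetPC S T p pc0
  Step S (rmFail p) T =
    PC S p ≡ pc2 × SameHeap S T × SetPC S T p pc0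
  Step S (rmOk p d) T =
    PC S p ≡ pc2 ×
    Σ Addr (λ c → OnMain S c × OnMain S d × c ≢ Tl × Next S c ≡ d ×
      Val S d ≡ nat (X S p) ×
      ((a : Addr) → Active T a ≡ Active S a) ×
      ((a : Addr) → Val T a ≡ Val S a) ×
      Next T c ≡ Next S d × ((b : Addr) → b ≢ c → Next T b ≡ Next S b)) ×
    SetPC S T p pc0
  Step S (rmNo p) T =
    PC S p ≡ pc2 ×
    ¬ (Σ Addr λ d → OnMain S d × Val S d ≡ nat (X S p)) ×
    SameHeap S T × SetPC S T p pc0
  Step S (c31 p) T =
    PC S p ≡ pc31 × SameHeap S T × Local S T p pc32 (X S p) Hd
  Step S (c32 p) T =
    PC S p ≡ pc32 × SameHeap S T ×
    ((Val S (Curr S p) <ᵛ nat (X S p) × SetPC S T p pc33) ⊎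
     (nat (X S p) ≤ᵛ Val S (Curr S p) × SetPC S T p pc35))
  Step S (c33 p) T =
    PC S p ≡ pc33 × SameHeap S T × Local S T p pc32 (X S p) (Next S (Curr S p))
  Step S (retYes p) T =
    PC S p ≡ pc35 × Val S (Curr S p) ≡ nat (X S p) × SameHeap S T × SetPC S T p pc0
  Step S (retNo p) T =
    PC S p ≡ pc35 × Val S (Curr S p) ≢ nat (X S p) × SameHeap S T × SetPC S T p pc0

  -- Length of a history: finitely many actions e_0..e_{N-1}, or infinite
  data Len : Set where
    fin : ℕ → Len
    infty : Len

  InRange : Len → ℕ → Set
  InRange (fin N) i = i < N
  InRange infty   i = ⊤

  StateIx : Len → ℕ → Set
  StateIx (fin N) i = i ≤ N
  StateIx infty   i = ⊤

  record History : Set where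
    field
      len   : Len
      S     : ℕ → State
      e     : ℕ → Label
      wf    : (i : ℕ) → StateIx len i → IsState (S i)
      init  : Initial (S 0)
      step  : (i : ℕ) → InRange len i → Step (S i) (e i) (S (suc i))

  inRange-< : (l : Len) {b r : ℕ} → b < r → InRange l r → InRange l b
  inRange-< (fin N) b<r r<N = <-≤-trans b<r (<⇒≤ r<N)
  inRange-< infty   _   _   = tt

  data IsRet (p : Proc) : Label → Set where
    isRetYes : IsRet p (retYes p)
    isRetNo  : IsRet p (retNo p)

  data IsAD : Label → Set where
    isAdFail  : ∀ {p} → IsAD (adFail p)
    isAdNew   : ∀ {p a} → IsAD (adNew p a)
    isAdFound : ∀ {p a} → IsAD (adFound p a)

  data IsRM : Label → Set where
    isRmFail : ∀ {p} → IsRM (rmFail p)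
    isRmOk   : ∀ {p d} → IsRM (rmOk p d)
    isRmNo   : ∀ {p} → IsRM (rmNo p)

  -- χ of a label (only meaningful for AD, RM and return actions)
  statusOf : Label → Status
  statusOf (adFail _)    = sf
  statusOf (adNew _ _)   = s0
  statusOf (adFound _ _) = s1
  statusOf (rmFail _)    = sf
  statusOf (rmOk _ _)    = s1
  statusOf (rmNo _)      = s0
  statusOf (retYes _)    = s1
  statusOf (retNo _)     = s0
  statusOf _             = s0

  -- adr of a label (only meaningful for adNew, adFound, rmOk)
  adrOf : Label → Addr
  adrOf (adNew _ a)   = a
  adrOf (adFound _ a) = a
  adrOf (rmOk _ d)    = d
  adrOf _             = Hd

  module _ (h : History) where
    open History h

    -- a complete CONTAINS execution of process p: from its execution of
    -- line 3.1 (action e_b) to the following return at 3.5 (action e_r)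
    CntExec : Proc → ℕ → ℕ → Set
    CntExec p b r =
      b < r × InRange len r × e b ≡ c31 p × IsRet p (e r) ×
      ((k : ℕ) → b < k → k < r → ¬ IsRet p (e k))

    -- events of M_H: the actions (low-level) and the complete CONTAINS
    -- executions (high-level)
    data Ev : Set where
      act : (i : ℕ) → InRange len i → Ev
      cnt : (p : Proc) (b r : ℕ) → CntExec p b r → Ev

    LowE : Ev → Set
    LowE (act _ _)     = ⊤
    LowE (cnt _ _ _ _) = ⊥

    BeginE EndE : Ev → Ev
    BeginE (act i q) = act i q
    BeginE (cnt p b r c) = act b (inRange-< len (proj₁ c) (proj₁ (proj₂ c)))
    EndE (act i q) = act i q
    EndE (cnt p b r c) = act r (proj₁ (proj₂ c))

    pos : Ev → ℕ
    pos (act i _)     = i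
    pos (cnt _ b _ _) = b

    _≺E_ : Ev → Ev → Set
    x ≺E y = pos (EndE x) < pos (BeginE y)

    AddE RemE CntE : Ev → Set
    AddE (act i _)     = IsAD (e i)
    AddE (cnt _ _ _ _) = ⊥
    RemE (act i _)     = IsRM (e i)
    RemE (cnt _ _ _ _) = ⊥
    CntE (act _ _)     = ⊥
    CntE (cnt _ _ _ _) = ⊤

    valE : Ev → ℕ
    valE (act i _)     = X (S i) (procOf (e i))
    valE (cnt p b _ _) = X (S b) p

    χE : Ev → Status
    χE (act i _)     = statusOf (e i)
    χE (cnt _ _ r _) = statusOf (e r)

    -- the address relevant to γ: adr(e) for actions, and the value of
    -- curr_p at the return for CONTAINS executions
    adrE : Ev → Addr
    adrE (act i _)     = adrOf (e i)
    adrE (cnt p _ r _) = Curr (S r) p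

    Activates : Ev → Addr → Set
    Activates (act i _) a     = Σ Proc λ p → e i ≡ adNew p a
    Activates (cnt _ _ _ _) a = ⊥

    M : (Ev → Ev) → Structure
    M g = record
      { Event = Ev ; Low = LowE ; Begin = BeginE ; End = EndE ; _≺_ = _≺E_
      ; Add = AddE ; Rem = RemE ; Cnt = CntE ; val = valE ; χ = χE ; γ = g }

    IsGamma : (Ev → Ev) → Set
    IsGamma g = (ev : Ev) → Op (M g) s1 ev → Activates (g ev) (adrE ev)

module Submission where

-- Every reachable state is normal: links out of active addresses go to active addresses of
-- larger value, so the main branch is sorted and an address on it is determined by its value.
-- An address leaves the main branch only through a successful RM and never returns, since an
-- AD always activates a fresh address. Hence a successful operation observes an address that
-- was activated earlier and still holds the operation's value; for a CONTAINS it was moreover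
-- not removed before the traversal began, because a traversal starting at time b only follows
-- links out of nodes that, at time b, were on the main branch or not yet allocated. Taking γ
-- to be the activation of that address gives A1. For A2, if nothing removed the address added
-- by A before the failing operation B ended, it stays on the main branch with value val(B);
-- then an AD would have found it, an RM would have removed it, and a CONTAINS, whose curr
-- still reaches it, would have returned 1.

open import Defs
open import Data.Bool using (true; false) renaming (_≟_ to _≟ᵇ_)
open import Data.Empty using (⊥; ⊥-elim)
open import Data.Fin using (Fin; toℕ; fromℕ<) renaming (_≟_ to _≟ᶠ_)
open import Data.Fin.Properties using (toℕ<n; toℕ-fromℕ<; any?)
open import Data.Nat using (ℕ; zero; suc; _<_; _≤_; z≤n; s≤s)
open import Data.Nat.Properties as ℕ
  using (<-cmp; <-irrefl; ≤-refl; ≤-trans; <-trans; <⇒≤; ≤-<-trans; <-≤-trans; <-irrelevant;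
         m≤n⇒m<n∨m≡n; m≤n⇒m≤1+n; n≤1+n; suc-injective)
open import Data.Product using (Σ; _×_; _,_; proj₁; proj₂)
open import Data.Sum using (_⊎_; inj₁; inj₂)
open import Data.Unit using (⊤; tt)
open import Effect.Monad using (RawMonad)
open import Level using (0ℓ)
open import Relation.Binary.Definitions using (Tri; tri<; tri≈; tri>)
open import Relation.Binary.PropositionalEquality using (_≡_; _≢_; refl; sym; trans; cong; subst; subst₂)
open import Relation.Nullary using (¬_; Dec; yes; no; _×-dec_; ¬¬-excluded-middle; decidable-stable)
open import Relation.Nullary.Decidable using (map′)
open import Relation.Nullary.Negation using (¬¬-Monad)

open RawMonad (¬¬-Monad {0ℓ}) using (pure; _>>=_)

-- Equality of addresses is undecidable, so case splits on it happen under double negation;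
-- the goals they serve are decidable and hence stable.
by-cases : (P : Set) {Q : Set} → (P → ¬ ¬ Q) → (¬ P → ¬ ¬ Q) → ¬ ¬ Q
by-cases P f g = ¬¬-excluded-middle >>= λ { (yes p) → f p ; (no ¬p) → g ¬p }

true≢false : ∀ {b} → b ≡ true → b ≡ false → ⊥
true≢false refl ()

nat-injective : ∀ {m n} → nat m ≡ nat n → m ≡ n
nat-injective refl = refl

<ᵛ-irrefl : ∀ {v} → ¬ v <ᵛ v
<ᵛ-irrefl (nat<nat m<m) = <-irrefl refl m<m

<ᵛ-trans : ∀ {u v w} → u <ᵛ v → v <ᵛ w → u <ᵛ w
<ᵛ-trans neg1<nat    (nat<nat _) = neg1<nat
<ᵛ-trans neg1<nat    nat<inf     = neg1<inf
<ᵛ-trans (nat<nat p) (nat<nat q) = nat<nat (<-trans p q)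
<ᵛ-trans (nat<nat _) nat<inf     = nat<inf

<-≤ᵛ-trans : ∀ {u v w} → u <ᵛ v → v ≤ᵛ w → u <ᵛ w
<-≤ᵛ-trans p (inj₁ q)    = <ᵛ-trans p q
<-≤ᵛ-trans p (inj₂ refl) = p

≤ᵛ⇒≯ᵛ : ∀ {v w} → v ≤ᵛ w → ¬ w <ᵛ v
≤ᵛ⇒≯ᵛ (inj₁ p)    q = <ᵛ-irrefl (<ᵛ-trans p q)
≤ᵛ⇒≯ᵛ (inj₂ refl) q = <ᵛ-irrefl q

≤ᵛ-antisym : ∀ {v w} → v ≤ᵛ w → w ≤ᵛ v → v ≡ w
≤ᵛ-antisym (inj₂ v≡w) _ = v≡w
≤ᵛ-antisym (inj₁ v<w) w≤v = ⊥-elim (≤ᵛ⇒≯ᵛ w≤v v<w)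

≤ᵛ∧≢⇒<ᵛ : ∀ {v w} → v ≤ᵛ w → v ≢ w → v <ᵛ w
≤ᵛ∧≢⇒<ᵛ (inj₁ v<w) _   = v<w
≤ᵛ∧≢⇒<ᵛ (inj₂ v≡w) v≢w = ⊥-elim (v≢w v≡w)

_<ᵛ?_ : (v w : V) → Dec (v <ᵛ w)
neg1  <ᵛ? neg1  = no λ ()
neg1  <ᵛ? nat _ = yes neg1<nat
neg1  <ᵛ? inf   = yes neg1<inf
nat _ <ᵛ? neg1  = no λ ()
nat m <ᵛ? nat n with m ℕ.<? n
... | yes m<n = yes (nat<nat m<n)
... | no  m≮n = no λ { (nat<nat m<n) → m≮n m<n }
nat _ <ᵛ? inf   = yes nat<inf
inf   <ᵛ? _     = no λ ()

module Heap (σ : Setting) where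
  open Setting σ

  SortedLink : State σ → Addr → Set
  SortedLink S a = Active S (Next S a) ≡ true × Val S a <ᵛ Val S (Next S a)

  Normal : State σ → Set
  Normal S = ∀ a → Active S a ≡ true → a ≢ Tl → SortedLink S a

  sortedLink? : (S : State σ) (a : Addr) → Dec (SortedLink S a)
  sortedLink? S a = Active S (Next S a) ≟ᵇ true ×-dec (Val S a <ᵛ? Val S (Next S a))

  data Reach (S : State σ) : Addr → Addr → Set where
    here  : ∀ {z} → Reach S z z
    there : ∀ {y z} → y ≢ Tl → Reach S (Next S y) z → Reach S y z

  reach-snoc : ∀ {S y z} → Reach S y z → z ≢ Tl → Reach S y (Next S z)
  reach-snoc here           z≢Tl = there z≢Tl here
  reach-snoc (there y≢Tl r) z≢Tl = there y≢Tl (reach-snoc r z≢Tl)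

  reach-tail : ∀ {S y z} → Reach S y z → y ≢ z → Reach S (Next S y) z
  reach-tail here        y≢y = ⊥-elim (y≢y refl)
  reach-tail (there _ r) _   = r

  main⇒reach : ∀ {S x} → OnMain σ S x → Reach S Hd x
  main⇒reach mHd             = here
  main⇒reach (mNext m x≢Tl) = reach-snoc (main⇒reach m) x≢Tl

  depth : ∀ {S x} → OnMain σ S x → ℕ
  depth mHd         = zero
  depth (mNext m _) = suc (depth m)

  depth-injective : ∀ {S x y} (p : OnMain σ S x) (q : OnMain σ S y) → depth p ≡ depth q → x ≡ y
  depth-injective mHd         mHd         _  = refl
  depth-injective {S} (mNext p _) (mNext q _) eq = cong (Next S) (depth-injective p q (suc-injective eq))

  module _ {S : State σ} (wS : IsState σ S) where
    hd-active : Active S Hd ≡ true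
    hd-active = proj₁ wS

    tl-active : Active S Tl ≡ true
    tl-active = proj₁ (proj₂ wS)

    hd-val : Val S Hd ≡ neg1
    hd-val = proj₁ (proj₂ (proj₂ wS))

    tl-val : Val S Tl ≡ inf
    tl-val = proj₁ (proj₂ (proj₂ (proj₂ wS)))

  module Sorted {S : State σ} (wS : IsState σ S) (nS : Normal S) where

    below⇒≢Tl : ∀ {u w} → Val S u <ᵛ w → u ≢ Tl
    below⇒≢Tl {w = w} u<w refl with subst (_<ᵛ w) (tl-val {S} wS) u<w
    ... | ()

    nat⇒≢Tl : ∀ {u n} → Val S u ≡ nat n → u ≢ Tl
    nat⇒≢Tl eq refl with trans (sym eq) (tl-val {S} wS)
    ... | ()

    nat⇒≢Hd : ∀ {u n} → Val S u ≡ nat n → u ≢ Hd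
    nat⇒≢Hd eq refl with trans (sym eq) (hd-val {S} wS)
    ... | ()

    active≢inactive : ∀ {a b} → Active S a ≡ true → Active S b ≡ false → a ≢ b
    active≢inactive t f refl = true≢false t f

    inactive⇒≢Tl : ∀ {a} → Active S a ≡ false → a ≢ Tl
    inactive⇒≢Tl f = λ a≡Tl → active≢inactive (tl-active {S} wS) f (sym a≡Tl)

    next-active : ∀ {x} → Active S x ≡ true → x ≢ Tl → Active S (Next S x) ≡ true
    next-active a x≢Tl = proj₁ (nS _ a x≢Tl)

    next-<ᵛ : ∀ {x} → Active S x ≡ true → x ≢ Tl → Val S x <ᵛ Val S (Next S x)
    next-<ᵛ a x≢Tl = proj₂ (nS _ a x≢Tl)

    main⇒active : ∀ {x} → OnMain σ S x → Active S x ≡ true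
    main⇒active mHd             = hd-active {S} wS
    main⇒active (mNext m x≢Tl) = next-active (main⇒active m) x≢Tl

    deeper⇒<ᵛ : ∀ {x y} (p : OnMain σ S x) (q : OnMain σ S y) → depth p < depth q → Val S x <ᵛ Val S y
    deeper⇒<ᵛ p (mNext {u} q u≢Tl) (s≤s p≤q) with m≤n⇒m<n∨m≡n p≤q
    ... | inj₁ p<q = <ᵛ-trans (deeper⇒<ᵛ p q p<q) (next-<ᵛ (main⇒active q) u≢Tl)
    ... | inj₂ p≡q = subst (λ z → Val S z <ᵛ Val S (Next S u)) (sym (depth-injective p q p≡q))
                       (next-<ᵛ (main⇒active q) u≢Tl)

    depth-unique : ∀ {x y} (p : OnMain σ S x) (q : OnMain σ S y) → x ≡ y → depth p ≡ depth q
    depth-unique p q refl with <-cmp (depth p) (depth q)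
    ... | tri< p<q _ _ = ⊥-elim (<ᵛ-irrefl (deeper⇒<ᵛ p q p<q))
    ... | tri≈ _ eq _  = eq
    ... | tri> _ _ q<p = ⊥-elim (<ᵛ-irrefl (deeper⇒<ᵛ q p q<p))

    main-≟ : ∀ {x y} → OnMain σ S x → OnMain σ S y → Dec (x ≡ y)
    main-≟ p q with depth p ℕ.≟ depth q
    ... | yes eq = yes (depth-injective p q eq)
    ... | no  ne = no λ x≡y → ne (depth-unique p q x≡y)

    main-next-injective : ∀ {x y} → OnMain σ S x → OnMain σ S y → x ≢ Tl → y ≢ Tl →
                          Next S x ≡ Next S y → x ≡ y
    main-next-injective p q x≢Tl y≢Tl eq =
      depth-injective p q (suc-injective (depth-unique (mNext p x≢Tl) (mNext q y≢Tl) eq))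

    gap-has-no-main-node : ∀ {u a x} → OnMain σ S u → OnMain σ S a →
      Val S u <ᵛ nat x → nat x ≤ᵛ Val S (Next S u) → Val S (Next S u) ≢ nat x → Val S a ≢ nat x
    gap-has-no-main-node {u} {a} {x} mu ma u<x x≤u⁺ u⁺≢x a≡x with <-cmp (depth ma) (depth mu)
    ... | tri< a<u _ _ = <ᵛ-irrefl (<ᵛ-trans (subst (_<ᵛ Val S u) a≡x (deeper⇒<ᵛ ma mu a<u)) u<x)
    ... | tri≈ _ a=u _ = <ᵛ-irrefl (subst (_<ᵛ nat x) (trans (cong (Val S) (depth-injective mu ma (sym a=u))) a≡x) u<x)
    ... | tri> _ _ u<a with m≤n⇒m<n∨m≡n u<a
    ...   | inj₂ u⁺=a = u⁺≢x (trans (cong (Val S) (depth-injective (mNext mu (below⇒≢Tl u<x)) ma u⁺=a)) a≡x)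
    ...   | inj₁ u⁺<a = ≤ᵛ⇒≯ᵛ x≤u⁺ (subst (Val S (Next S u) <ᵛ_) a≡x (deeper⇒<ᵛ (mNext mu (below⇒≢Tl u<x)) ma u⁺<a))

    reach⇒≤ᵛ : ∀ {y z} → Active S y ≡ true → Reach S y z → Val S y ≤ᵛ Val S z
    reach⇒≤ᵛ _ here             = inj₂ refl
    reach⇒≤ᵛ a (there y≢Tl r) = inj₁ (<-≤ᵛ-trans (next-<ᵛ a y≢Tl) (reach⇒≤ᵛ (next-active a y≢Tl) r))

  record Insertion (S T : State σ) (x : ℕ) (a : Addr) : Set where
    field
      after        : Addr
      after-main   : OnMain σ S after
      after-below  : Val S after <ᵛ nat x
      x≤successor  : nat x ≤ᵛ Val S (Next S after)
      successor≢x  : Val S (Next S after) ≢ nat x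
      fresh        : Active S a ≡ false
      activated    : Active T a ≡ true
      active-other : ∀ b → b ≢ a → Active T b ≡ Active S b
      val-new      : Val T a ≡ nat x
      val-other    : ∀ b → b ≢ a → Val T b ≡ Val S b
      next-after   : Next T after ≡ a
      next-new     : Next T a ≡ Next S after
      next-other   : ∀ b → b ≢ after → b ≢ a → Next T b ≡ Next S b

  record Unlinking (S T : State σ) (x : ℕ) (d : Addr) : Set where
    field
      before       : Addr
      before-main  : OnMain σ S before
      removed-main : OnMain σ S d
      before≢Tl    : before ≢ Tl
      next-before  : Next S before ≡ d
      val-removed  : Val S d ≡ nat x
      active-same  : ∀ a → Active T a ≡ Active S a
      val-same     : ∀ a → Val T a ≡ Val S a
      bypass       : Next T before ≡ Next S d
      next-other   : ∀ b → b ≢ before → Next T b ≡ Next S b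

  data HeapEffect (S : State σ) (l : Label σ) (T : State σ) : Set where
    unchanged : SameHeap σ S T → HeapEffect S l T
    inserted  : ∀ {p a} → l ≡ adNew p a → Insertion S T (X S p) a → HeapEffect S l T
    unlinked  : ∀ {p d} → l ≡ rmOk p d → Unlinking S T (X S p) d → HeapEffect S l T

  insertion : ∀ {S T p a} → Step σ S (adNew p a) T → Insertion S T (X S p) a
  insertion (_ , (u , mu , u<x , x≤u⁺ , u⁺≢x , fr , (on , on-o) , (val , val-o) , (nu , na , next-o)) , _) =
    record { after = u ; after-main = mu ; after-below = u<x ; x≤successor = x≤u⁺ ; successor≢x = u⁺≢x
           ; fresh = fr ; activated = on ; active-other = on-o ; val-new = val ; val-other = val-o
           ; next-after = nu ; next-new = na ; next-other = next-o }

  unlinking : ∀ {S T p d} → Step σ S (rmOk p d) T → Unlinking S T (X S p) d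
  unlinking (_ , (c , mc , md , c≢Tl , ncd , vd , same-act , same-val , nc , next-o) , _) =
    record { before = c ; before-main = mc ; removed-main = md ; before≢Tl = c≢Tl ; next-before = ncd
           ; val-removed = vd ; active-same = same-act ; val-same = same-val ; bypass = nc ; next-other = next-o }

  heapEffect : ∀ {S T} (l : Label σ) → Step σ S l T → HeapEffect S l T
  heapEffect (inv _ _ _)   st = unchanged (proj₁ (proj₂ st))
  heapEffect (adFail _)    st = unchanged (proj₁ (proj₂ st))
  heapEffect (adNew _ _)   st = inserted refl (insertion st)
  heapEffect (adFound _ _) st = unchanged (proj₁ (proj₂ (proj₂ st)))
  heapEffect (rmFail _)    st = unchanged (proj₁ (proj₂ st))
  heapEffect (rmOk _ _)    st = unlinked refl (unlinking st)
  heapEffect (rmNo _)      st = unchanged (proj₁ (proj₂ (proj₂ st)))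
  heapEffect (c31 _)       st = unchanged (proj₁ (proj₂ st))
  heapEffect (c32 _)       st = unchanged (proj₁ (proj₂ st))
  heapEffect (c33 _)       st = unchanged (proj₁ (proj₂ st))
  heapEffect (retYes _)    st = unchanged (proj₁ (proj₂ (proj₂ st)))
  heapEffect (retNo _)     st = unchanged (proj₁ (proj₂ (proj₂ st)))

  link-to : ∀ {T : State σ} {b w : Addr} → Next T b ≡ w → Active T w ≡ true → Val T b <ᵛ Val T w → SortedLink T b
  link-to refl w-active b<w = w-active , b<w

  <ᵛ-cong : ∀ {v v′ w w′ : V} → v ≡ v′ → w ≡ w′ → v′ <ᵛ w′ → v <ᵛ w
  <ᵛ-cong refl refl v<w = v<w

  module StepFacts {S T : State σ} (wS : IsState σ S) (nS : Normal S) where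
    open Sorted {S} wS nS

    active-mono : ∀ {l} → HeapEffect S l T → ∀ a → Active S a ≡ true → Active T a ≡ true
    active-mono (unchanged (same-act , _)) a on = trans (same-act a) on
    active-mono (inserted _ D) a on = trans (active-other a (active≢inactive on fresh)) on
      where open Insertion D
    active-mono (unlinked _ D) a on = trans (active-same a) on
      where open Unlinking D

    val-stable : ∀ {l} → HeapEffect S l T → ∀ a → Active S a ≡ true → Val T a ≡ Val S a
    val-stable (unchanged (_ , same-val , _)) a _ = same-val a
    val-stable (inserted _ D) a on = val-other a (active≢inactive on fresh)
      where open Insertion D
    val-stable (unlinked _ D) a _ = val-same a
      where open Unlinking D

    SuccessorOrigin : Addr → Set
    SuccessorOrigin y = OnMain σ S (Next T y) ⊎ Active S (Next T y) ≡ false ⊎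
                        (Active S y ≡ true × ¬ OnMain σ S y × Next T y ≡ Next S y)

    module AfterSameHeap (H : SameHeap σ S T) where
      same-act : ∀ a → Active T a ≡ Active S a
      same-act = proj₁ H

      same-val : ∀ a → Val T a ≡ Val S a
      same-val = proj₁ (proj₂ H)

      same-next : ∀ a → Next T a ≡ Next S a
      same-next = proj₂ (proj₂ H)

      sorted : Normal T
      sorted b on b≢Tl =
        let (c-active , b<c) = nS b (trans (sym (same-act b)) on) b≢Tl
        in link-to {T} (same-next b) (trans (same-act _) c-active) (<ᵛ-cong (same-val b) (same-val _) b<c)

      main-before : ∀ {x} → OnMain σ T x → OnMain σ S x
      main-before mHd              = mHd
      main-before (mNext {y} m y≢Tl) = subst (OnMain σ S) (sym (same-next y)) (mNext (main-before m) y≢Tl)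

      main-after : ∀ {x} → OnMain σ S x → OnMain σ T x
      main-after mHd              = mHd
      main-after (mNext {y} m y≢Tl) = subst (OnMain σ T) (same-next y) (mNext (main-after m) y≢Tl)

      reach-preserved : ∀ {y z} → Reach S y z → Reach T y z
      reach-preserved here                 = here
      reach-preserved (there {y} {z} y≢Tl r) =
        there y≢Tl (subst (λ w → Reach T w z) (sym (same-next y)) (reach-preserved r))

      successor-origin : ∀ y → Active T y ≡ true → y ≢ Tl → ¬ ¬ SuccessorOrigin y
      successor-origin y on y≢Tl = by-cases (OnMain σ S y)
        (λ my → pure (inj₁ (subst (OnMain σ S) (sym (same-next y)) (mNext my y≢Tl))))
        (λ ¬my → pure (inj₂ (inj₂ (trans (sym (same-act y)) on , ¬my , same-next y))))

    module AfterInsertion {x a} (D : Insertion S T x a) where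
      open Insertion D

      after≢Tl : after ≢ Tl
      after≢Tl = below⇒≢Tl after-below

      after-active : Active S after ≡ true
      after-active = main⇒active after-main

      successor-active : Active S (Next S after) ≡ true
      successor-active = next-active after-active after≢Tl

      sorted-new : SortedLink T a
      sorted-new = link-to {T} next-new
        (trans (active-other _ (active≢inactive successor-active fresh)) successor-active)
        (<ᵛ-cong val-new (val-other _ (active≢inactive successor-active fresh))
          (≤ᵛ∧≢⇒<ᵛ x≤successor (λ eq → successor≢x (sym eq))))

      sorted-after : SortedLink T after
      sorted-after = link-to {T} next-after activated
        (<ᵛ-cong (val-other after (active≢inactive after-active fresh)) val-new after-below)

      sorted-other : ∀ b → Active T b ≡ true → b ≢ Tl → b ≢ a → b ≢ after → SortedLink T b
      sorted-other b on b≢Tl b≢a b≢after =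
        let (c-active , b<c) = nS b (trans (sym (active-other b b≢a)) on) b≢Tl
            c≢a = active≢inactive c-active fresh
        in link-to {T} (next-other b b≢after b≢a) (trans (active-other _ c≢a) c-active)
             (<ᵛ-cong (val-other b b≢a) (val-other _ c≢a) b<c)

      sorted : Normal T
      sorted b on b≢Tl = decidable-stable (sortedLink? T b)
        (by-cases (b ≡ a) (λ { refl → pure sorted-new }) λ b≢a →
         by-cases (b ≡ after) (λ { refl → pure sorted-after }) λ b≢after →
         pure (sorted-other b on b≢Tl b≢a b≢after))

      main-before : ∀ {y} → OnMain σ T y → OnMain σ S y ⊎ y ≡ a
      main-before mHd = inj₁ mHd
      main-before (mNext {y} m y≢Tl) with main-before m
      ... | inj₂ refl = inj₁ (subst (OnMain σ S) (sym next-new) (mNext after-main after≢Tl))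
      ... | inj₁ my with main-≟ my after-main
      ...   | yes refl = inj₂ next-after
      ...   | no y≢after = inj₁ (subst (OnMain σ S)
                (sym (next-other y y≢after (active≢inactive (main⇒active my) fresh))) (mNext my y≢Tl))

      main-after : ∀ {y} → OnMain σ S y → OnMain σ T y
      main-after mHd = mHd
      main-after (mNext {y} m y≢Tl) with main-≟ m after-main
      ... | yes refl = subst (OnMain σ T) next-new
              (mNext (subst (OnMain σ T) next-after (mNext (main-after m) after≢Tl)) (inactive⇒≢Tl fresh))
      ... | no y≢after = subst (OnMain σ T) (next-other y y≢after (active≢inactive (main⇒active m) fresh))
              (mNext (main-after m) y≢Tl)

      reach-preserved : ∀ {y z} → Active S y ≡ true → Reach S y z → ¬ ¬ Reach T y z
      reach-preserved _ here = pure here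
      reach-preserved {z = z} on (there {y} y≢Tl r) =
        reach-preserved (next-active on y≢Tl) r >>= λ rT →
        by-cases (y ≡ after)
          (λ { refl → pure (there after≢Tl (subst (λ w → Reach T w z) (sym next-after)
                       (there (inactive⇒≢Tl fresh) (subst (λ w → Reach T w z) (sym next-new) rT)))) })
          (λ y≢after → pure (there y≢Tl (subst (λ w → Reach T w z)
                       (sym (next-other y y≢after (active≢inactive on fresh))) rT)))

      successor-origin : ∀ y → Active T y ≡ true → y ≢ Tl → ¬ ¬ SuccessorOrigin y
      successor-origin y on y≢Tl =
        by-cases (y ≡ a)
          (λ { refl → pure (inj₁ (subst (OnMain σ S) (sym next-new) (mNext after-main after≢Tl))) })
          λ y≢a → by-cases (OnMain σ S y)
            (λ my → case-main y≢a my (main-≟ my after-main))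
            (λ ¬my → pure (inj₂ (inj₂ (trans (sym (active-other y y≢a)) on , ¬my ,
                       next-other y (λ { refl → ¬my after-main }) y≢a))))
        where
          case-main : y ≢ a → OnMain σ S y → Dec (y ≡ after) → ¬ ¬ SuccessorOrigin y
          case-main _ _ (yes refl) = pure (inj₂ (inj₁ (subst (λ w → Active S w ≡ false) (sym next-after) fresh)))
          case-main y≢a my (no y≢after) = pure (inj₁ (subst (OnMain σ S) (sym (next-other y y≢after y≢a)) (mNext my y≢Tl)))

    module AfterUnlinking {x d} (D : Unlinking S T x d) where
      open Unlinking D

      d≢Tl : d ≢ Tl
      d≢Tl = nat⇒≢Tl val-removed

      d-active : Active S d ≡ true
      d-active = main⇒active removed-main

      d<successor : Val S d <ᵛ Val S (Next S d)
      d<successor = next-<ᵛ d-active d≢Tl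

      sorted-bypass : SortedLink T before
      sorted-bypass = link-to {T} bypass (trans (active-same _) (next-active d-active d≢Tl))
        (<ᵛ-cong (val-same _) (val-same _) (<ᵛ-trans before<d d<successor))
        where
          before<d : Val S before <ᵛ Val S d
          before<d = subst (λ z → Val S before <ᵛ Val S z) next-before
                       (next-<ᵛ (main⇒active before-main) before≢Tl)

      sorted-other : ∀ b → Active T b ≡ true → b ≢ Tl → b ≢ before → SortedLink T b
      sorted-other b on b≢Tl b≢before =
        let (c-active , b<c) = nS b (trans (sym (active-same b)) on) b≢Tl
        in link-to {T} (next-other b b≢before) (trans (active-same _) c-active)
             (<ᵛ-cong (val-same b) (val-same _) b<c)

      sorted : Normal T
      sorted b on b≢Tl = decidable-stable (sortedLink? T b)
        (by-cases (b ≡ before) (λ { refl → pure sorted-bypass }) λ b≢before →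
         pure (sorted-other b on b≢Tl b≢before))

      main-before : ∀ {y} → OnMain σ T y → OnMain σ S y × y ≢ d
      main-before mHd = mHd , λ Hd≡d → nat⇒≢Hd val-removed (sym Hd≡d)
      main-before (mNext {y} m y≢Tl) with main-before m
      ... | (my , y≢d) with main-≟ my before-main
      ...   | yes refl = subst (OnMain σ S) (sym bypass) (mNext removed-main d≢Tl) ,
                         λ eq → <ᵛ-irrefl (subst (λ z → Val S d <ᵛ Val S z) (trans (sym bypass) eq) d<successor)
      ...   | no y≢before = subst (OnMain σ S) (sym (next-other y y≢before)) (mNext my y≢Tl) ,
                            λ eq → y≢before (main-next-injective my before-main y≢Tl before≢Tl
                                     (trans (sym (next-other y y≢before)) (trans eq (sym next-before))))

      main-after-or-bypassed : ∀ {y} → OnMain σ S y → (y ≢ d → OnMain σ T y) × (y ≡ d → OnMain σ T (Next S d))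
      main-after-or-bypassed mHd = (λ _ → mHd) , λ Hd≡d → ⊥-elim (nat⇒≢Hd val-removed (sym Hd≡d))
      main-after-or-bypassed (mNext {y} m y≢Tl) with main-≟ m removed-main
      ... | yes refl = (λ _ → proj₂ (main-after-or-bypassed m) refl) ,
                       λ eq → ⊥-elim (<ᵛ-irrefl (subst (λ z → Val S d <ᵛ Val S z) eq d<successor))
      ... | no y≢d with main-≟ m before-main
      ...   | yes refl = (λ y⁺≢d → ⊥-elim (y⁺≢d next-before)) ,
                         λ _ → subst (OnMain σ T) bypass (mNext (proj₁ (main-after-or-bypassed m) y≢d) before≢Tl)
      ...   | no y≢before = (λ _ → subst (OnMain σ T) (next-other y y≢before)
                                      (mNext (proj₁ (main-after-or-bypassed m) y≢d) y≢Tl)) ,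
                            λ eq → ⊥-elim (y≢before (main-next-injective m before-main y≢Tl before≢Tl
                                                      (trans eq (sym next-before))))

      main-after : ∀ {y} → OnMain σ S y → y ≢ d → OnMain σ T y
      main-after m = proj₁ (main-after-or-bypassed m)

      reach-preserved : ∀ {y z} → d ≢ z → Active S y ≡ true → Reach S y z → ¬ ¬ Reach T y z
      reach-preserved _ _ here = pure here
      reach-preserved d≢z on (there {y} y≢Tl here) = by-cases (y ≡ before)
        (λ { refl → ⊥-elim (d≢z (sym next-before)) })
        (λ y≢before → pure (there y≢Tl (subst (λ w → Reach T w (Next S y)) (sym (next-other y y≢before)) here)))
      reach-preserved {z = z} d≢z on (there {y} y≢Tl (there y⁺≢Tl r)) = by-cases (y ≡ before)
        (λ { refl → reach-preserved d≢z (next-active (next-active on y≢Tl) y⁺≢Tl) r >>= λ rT →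
               pure (there before≢Tl (subst (λ w → Reach T w z)
                 (sym (trans bypass (cong (Next S) (sym next-before)))) rT)) })
        (λ y≢before → reach-preserved d≢z (next-active on y≢Tl) (there y⁺≢Tl r) >>= λ rT →
           pure (there y≢Tl (subst (λ w → Reach T w z) (sym (next-other y y≢before)) rT)))

      successor-origin : ∀ y → Active T y ≡ true → y ≢ Tl → ¬ ¬ SuccessorOrigin y
      successor-origin y on y≢Tl = by-cases (OnMain σ S y)
        (λ my → pure (inj₁ (case-main my (main-≟ my before-main))))
        (λ ¬my → pure (inj₂ (inj₂ (trans (sym (active-same y)) on , ¬my ,
                   next-other y (λ { refl → ¬my before-main })))))
        where
          case-main : OnMain σ S y → Dec (y ≡ before) → OnMain σ S (Next T y)
          case-main _  (yes refl)     = subst (OnMain σ S) (sym bypass) (mNext removed-main d≢Tl)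
          case-main my (no y≢before) = subst (OnMain σ S) (sym (next-other y y≢before)) (mNext my y≢Tl)

    normal-preserved : ∀ {l} → HeapEffect S l T → Normal T
    normal-preserved (unchanged H)  = AfterSameHeap.sorted H
    normal-preserved (inserted _ D) = AfterInsertion.sorted D
    normal-preserved (unlinked _ D) = AfterUnlinking.sorted D

    main-before : ∀ {l x} → HeapEffect S l T → OnMain σ T x → OnMain σ S x ⊎ Σ (Proc σ) (λ p → l ≡ adNew p x)
    main-before (unchanged H) m = inj₁ (AfterSameHeap.main-before H m)
    main-before (inserted {p} l≡adNew D) m with AfterInsertion.main-before D m
    ... | inj₁ m′   = inj₁ m′
    ... | inj₂ refl = inj₂ (p , l≡adNew)
    main-before (unlinked _ D) m = inj₁ (proj₁ (AfterUnlinking.main-before D m))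

    main-after : ∀ {l x} → HeapEffect S l T → OnMain σ S x → (∀ p → l ≢ rmOk p x) → OnMain σ T x
    main-after (unchanged H)  m _ = AfterSameHeap.main-after H m
    main-after (inserted _ D) m _ = AfterInsertion.main-after D m
    main-after (unlinked {p} l≡rmOk D) m not-removed =
      AfterUnlinking.main-after D m λ { refl → not-removed p l≡rmOk }

    reach-preserved : ∀ {l y z} → HeapEffect S l T → (∀ p → l ≢ rmOk p z) →
                      Active S y ≡ true → Reach S y z → ¬ ¬ Reach T y z
    reach-preserved (unchanged H)  _ _ r = pure (AfterSameHeap.reach-preserved H r)
    reach-preserved (inserted _ D) _ on r = AfterInsertion.reach-preserved D on r
    reach-preserved (unlinked {p} l≡rmOk D) not-removed on r =
      AfterUnlinking.reach-preserved D (λ { refl → not-removed p l≡rmOk }) on r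

    successor-origin : ∀ {l} → HeapEffect S l T → ∀ y → Active T y ≡ true → y ≢ Tl → ¬ ¬ SuccessorOrigin y
    successor-origin (unchanged H)  = AfterSameHeap.successor-origin H
    successor-origin (inserted _ D) = AfterInsertion.successor-origin D
    successor-origin (unlinked _ D) = AfterUnlinking.successor-origin D

module Labels (σ : Setting) where
  open Setting σ

  rmOk-injective : ∀ {p q : Proc σ} {a b} → _≡_ {A = Label σ} (rmOk p a) (rmOk q b) → a ≡ b
  rmOk-injective refl = refl

  adNew-injective : ∀ {p q : Proc σ} {a b} → _≡_ {A = Label σ} (adNew p a) (adNew q b) → a ≡ b
  adNew-injective refl = refl

  adNew≢rmOk : ∀ {p q : Proc σ} {a d} → _≢_ {A = Label σ} (adNew p a) (rmOk q d)
  adNew≢rmOk ()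

  UpdateOp : Label σ → Set
  UpdateOp l = IsAD σ l ⊎ IsRM σ l ⊎ ⊥

  AD≢RM : ∀ {l} → IsAD σ l → ¬ IsRM σ l
  AD≢RM isAdFail  ()
  AD≢RM isAdNew   ()
  AD≢RM isAdFound ()

  AD-status0 : ∀ (l : Label σ) → IsAD σ l → statusOf σ l ≡ s0 → Σ (Proc σ) λ p → Σ Addr λ a → l ≡ adNew p a
  AD-status0 _ (isAdNew {p} {a}) _ = p , a , refl

  RM-status1 : ∀ (l : Label σ) → IsRM σ l → statusOf σ l ≡ s1 → Σ (Proc σ) λ p → Σ Addr λ d → l ≡ rmOk p d
  RM-status1 _ (isRmOk {p} {d}) _ = p , d , refl

  update-status1 : ∀ (l : Label σ) → UpdateOp l → statusOf σ l ≡ s1 →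
    (Σ (Proc σ) λ p → Σ Addr λ a → l ≡ adFound p a) ⊎ (Σ (Proc σ) λ p → Σ Addr λ d → l ≡ rmOk p d)
  update-status1 _ (inj₁ (isAdFound {p} {a})) _ = inj₁ (p , a , refl)
  update-status1 _ (inj₂ (inj₁ (isRmOk {p} {d}))) _ = inj₂ (p , d , refl)

  update-status0 : ∀ (l : Label σ) → UpdateOp l → statusOf σ l ≡ s0 →
    (Σ (Proc σ) λ p → Σ Addr λ a → l ≡ adNew p a) ⊎ (Σ (Proc σ) λ p → l ≡ rmNo p)
  update-status0 _ (inj₁ (isAdNew {p} {a})) _ = inj₁ (p , a , refl)
  update-status0 _ (inj₂ (inj₁ (isRmNo {p}))) _ = inj₂ (p , refl)

  return-status1 : ∀ {p} (l : Label σ) → IsRet σ p l → statusOf σ l ≡ s1 → l ≡ retYes p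
  return-status1 _ isRetYes _ = refl

  return-status0 : ∀ {p} (l : Label σ) → IsRet σ p l → statusOf σ l ≡ s0 → l ≡ retNo p
  return-status0 _ isRetNo _ = refl

  successful-update? : ∀ (l : Label σ) → Dec (UpdateOp l × statusOf σ l ≡ s1)
  successful-update? (adFound _ _) = yes (inj₁ isAdFound , refl)
  successful-update? (rmOk _ _)    = yes (inj₂ (inj₁ isRmOk) , refl)
  successful-update? (retYes _)    = no λ { (inj₁ () , _) ; (inj₂ (inj₁ ()) , _) ; (inj₂ (inj₂ ()) , _) }
  successful-update? (inv _ _ _)   = no λ { (_ , ()) }
  successful-update? (adFail _)    = no λ { (_ , ()) }
  successful-update? (adNew _ _)   = no λ { (_ , ()) }
  successful-update? (rmFail _)    = no λ { (_ , ()) }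
  successful-update? (rmNo _)      = no λ { (_ , ()) }
  successful-update? (c31 _)       = no λ { (_ , ()) }
  successful-update? (c32 _)       = no λ { (_ , ()) }
  successful-update? (c33 _)       = no λ { (_ , ()) }
  successful-update? (retNo _)     = no λ { (_ , ()) }

  rmOk? : ∀ (l : Label σ) → (Σ (Proc σ) λ p → Σ Addr λ d → l ≡ rmOk p d) ⊎ (∀ (p : Proc σ) d → l ≢ rmOk p d)
  rmOk? (rmOk p d)    = inj₁ (p , d , refl)
  rmOk? (inv _ _ _)   = inj₂ λ _ _ ()
  rmOk? (adFail _)    = inj₂ λ _ _ ()
  rmOk? (adNew _ _)   = inj₂ λ _ _ ()
  rmOk? (adFound _ _) = inj₂ λ _ _ ()
  rmOk? (rmFail _)    = inj₂ λ _ _ ()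
  rmOk? (rmNo _)      = inj₂ λ _ _ ()
  rmOk? (c31 _)       = inj₂ λ _ _ ()
  rmOk? (c32 _)       = inj₂ λ _ _ ()
  rmOk? (c33 _)       = inj₂ λ _ _ ()
  rmOk? (retYes _)    = inj₂ λ _ _ ()
  rmOk? (retNo _)     = inj₂ λ _ _ ()

  upd-same : ∀ {A : Set} (f : Proc σ → A) p v → upd σ f p v p ≡ v
  upd-same f p v with p ≟ᶠ p
  ... | yes _  = refl
  ... | no p≢p = ⊥-elim (p≢p refl)

  upd-other : ∀ {A : Set} (f : Proc σ → A) p q v → q ≢ p → upd σ f p v q ≡ f q
  upd-other f p q v q≢p with q ≟ᶠ p
  ... | yes q≡p = ⊥-elim (q≢p q≡p)
  ... | no _    = refl

  module _ {S T : State σ} {p : Proc σ} {pc x c} (L : Local σ S T p pc x c) where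
    private
      pc≡ : ∀ q → PC T q ≡ upd σ (PC S) p pc q
      pc≡ = proj₁ L

      x≡ : ∀ q → X T q ≡ upd σ (X S) p x q
      x≡ = proj₁ (proj₂ L)

      curr≡ : ∀ q → Curr T q ≡ upd σ (Curr S) p c q
      curr≡ = proj₂ (proj₂ L)

    own-locals : PC T p ≡ pc × X T p ≡ x × Curr T p ≡ c
    own-locals = trans (pc≡ p) (upd-same (PC S) p pc) , trans (x≡ p) (upd-same (X S) p x) ,
                 trans (curr≡ p) (upd-same (Curr S) p c)

    others-locals : ∀ q → q ≢ p → PC T q ≡ PC S q × X T q ≡ X S q × Curr T q ≡ Curr S q
    others-locals q q≢p = trans (pc≡ q) (upd-other (PC S) p q pc q≢p) , trans (x≡ q) (upd-other (X S) p q x q≢p) ,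
                          trans (curr≡ q) (upd-other (Curr S) p q c q≢p)

  locals : ∀ {S T} (l : Label σ) → Step σ S l T → Σ PCv λ pc → Σ ℕ λ x → Σ Addr λ c → Local σ S T (procOf σ l) pc x c
  locals (inv _ _ _)   st = _ , _ , _ , proj₂ (proj₂ st)
  locals (adFail _)    st = _ , _ , _ , proj₂ (proj₂ st)
  locals (adNew _ _)   st = _ , _ , _ , proj₂ (proj₂ st)
  locals (adFound _ _) st = _ , _ , _ , proj₂ (proj₂ (proj₂ st))
  locals (rmFail _)    st = _ , _ , _ , proj₂ (proj₂ st)
  locals (rmOk _ _)    st = _ , _ , _ , proj₂ (proj₂ st)
  locals (rmNo _)      st = _ , _ , _ , proj₂ (proj₂ (proj₂ st))
  locals (c31 _)       st = _ , _ , _ , proj₂ (proj₂ st)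
  locals (c32 _) (_ , _ , inj₁ (_ , L)) = _ , _ , _ , L
  locals (c32 _) (_ , _ , inj₂ (_ , L)) = _ , _ , _ , L
  locals (c33 _)       st = _ , _ , _ , proj₂ (proj₂ st)
  locals (retYes _)    st = _ , _ , _ , proj₂ (proj₂ (proj₂ st))
  locals (retNo _)     st = _ , _ , _ , proj₂ (proj₂ (proj₂ st))

  data InLoop : PCv → Set where
    at32 : InLoop pc32
    at33 : InLoop pc33
    at35 : InLoop pc35

  data TraversalStep (S T : State σ) (p : Proc σ) : Set where
    idle    : PC T p ≡ PC S p → X T p ≡ X S p → Curr T p ≡ Curr S p → TraversalStep S T p
    proceed : PC S p ≡ pc32 → Val S (Curr S p) <ᵛ nat (X S p) →
              PC T p ≡ pc33 → X T p ≡ X S p → Curr T p ≡ Curr S p → TraversalStep S T p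
    stop    : PC S p ≡ pc32 → nat (X S p) ≤ᵛ Val S (Curr S p) →
              PC T p ≡ pc35 → X T p ≡ X S p → Curr T p ≡ Curr S p → TraversalStep S T p
    advance : PC S p ≡ pc33 → PC T p ≡ pc32 → X T p ≡ X S p → Curr T p ≡ Next S (Curr S p) →
              TraversalStep S T p

  own-traversal-step : ∀ {S T} (l : Label σ) {p} → procOf σ l ≡ p → Step σ S l T →
                       InLoop (PC S p) → ¬ IsRet σ p l → TraversalStep S T p
  own-traversal-step {S} {T} (c32 p) refl (pc≡ , _ , inj₁ (below , L)) _ _ =
    let (pc′ , x′ , curr′) = own-locals {S} {T} L in proceed pc≡ below pc′ x′ curr′
  own-traversal-step {S} {T} (c32 p) refl (pc≡ , _ , inj₂ (reached , L)) _ _ =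
    let (pc′ , x′ , curr′) = own-locals {S} {T} L in stop pc≡ reached pc′ x′ curr′
  own-traversal-step {S} {T} (c33 p) refl (pc≡ , _ , L) _ _ =
    let (pc′ , x′ , curr′) = own-locals {S} {T} L in advance pc≡ pc′ x′ curr′
  own-traversal-step (retYes p) refl _ _ not-ret = ⊥-elim (not-ret isRetYes)
  own-traversal-step (retNo p)  refl _ _ not-ret = ⊥-elim (not-ret isRetNo)
  own-traversal-step (inv _ _ _)   refl st in-loop _ with subst InLoop (proj₁ st) in-loop
  ... | ()
  own-traversal-step (adFail _)    refl st in-loop _ with subst InLoop (proj₁ st) in-loop
  ... | ()
  own-traversal-step (adNew _ _)   refl st in-loop _ with subst InLoop (proj₁ st) in-loop
  ... | ()
  own-traversal-step (adFound _ _) refl st in-loop _ with subst InLoop (proj₁ st) in-loop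
  ... | ()
  own-traversal-step (rmFail _)    refl st in-loop _ with subst InLoop (proj₁ st) in-loop
  ... | ()
  own-traversal-step (rmOk _ _)    refl st in-loop _ with subst InLoop (proj₁ st) in-loop
  ... | ()
  own-traversal-step (rmNo _)      refl st in-loop _ with subst InLoop (proj₁ st) in-loop
  ... | ()
  own-traversal-step (c31 _)       refl st in-loop _ with subst InLoop (proj₁ st) in-loop
  ... | ()

  traversal-step : ∀ {S T} (l : Label σ) {p} → Step σ S l T → InLoop (PC S p) → ¬ IsRet σ p l → TraversalStep S T p
  traversal-step {S} {T} l {p} st in-loop not-ret with procOf σ l ≟ᶠ p
  ... | yes own = own-traversal-step l own st in-loop not-ret
  ... | no other with locals l st
  ...   | (_ , _ , _ , L) = let (pc′ , x′ , curr′) = others-locals {S} {T} L p (λ eq → other (sym eq)) in idle pc′ x′ curr′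

module _ {σ : Setting} where

  in-range⇒state : (l : Len σ) {t : ℕ} → InRange σ l t → StateIx σ l t
  in-range⇒state (fin _) q = <⇒≤ q
  in-range⇒state infty   _ = tt

  in-range⇒state-suc : (l : Len σ) {t : ℕ} → InRange σ l t → StateIx σ l (suc t)
  in-range⇒state-suc (fin _) q = q
  in-range⇒state-suc infty   _ = tt

  state-suc⇒in-range : (l : Len σ) {t : ℕ} → StateIx σ l (suc t) → InRange σ l t
  state-suc⇒in-range (fin _) q = q
  state-suc⇒in-range infty   _ = tt

  state-<⇒in-range : (l : Len σ) {j t : ℕ} → j < t → StateIx σ l t → InRange σ l j
  state-<⇒in-range (fin _) j<t q = <-≤-trans j<t q
  state-<⇒in-range infty   _   _ = tt

  state-≤ : (l : Len σ) {t t′ : ℕ} → t ≤ t′ → StateIx σ l t′ → StateIx σ l t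
  state-≤ (fin _) t≤t′ q = ≤-trans t≤t′ q
  state-≤ infty   _    _ = tt

  in-range-≤ : (l : Len σ) {t t′ : ℕ} → t ≤ t′ → InRange σ l t′ → InRange σ l t
  in-range-≤ (fin _) t≤t′ q = ≤-<-trans t≤t′ q
  in-range-≤ infty   _    _ = tt

  in-range-irrelevant : (l : Len σ) {t : ℕ} (q q′ : InRange σ l t) → q ≡ q′
  in-range-irrelevant (fin _) q q′ = <-irrelevant q q′
  in-range-irrelevant infty   _ _  = refl

  state-zero : (l : Len σ) → StateIx σ l 0
  state-zero (fin _) = z≤n
  state-zero infty   = tt

module Run (σ : Setting) (h : History σ) where
  open Setting σ
  open History h
  open Heap σ
  open Labels σ

  ValidState ValidAction : ℕ → Set
  ValidState  = StateIx σ len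
  ValidAction = InRange σ len

  effect : ∀ t → ValidAction t → HeapEffect (S t) (e t) (S (suc t))
  effect t q = heapEffect (e t) (step t q)

  step-as : ∀ {k} {l : Label σ} → ValidAction k → e k ≡ l → Step σ (S k) l (S (suc k))
  step-as {k} q refl = step k q

  initial-normal : Normal (S 0)
  initial-normal a on a≢Tl with proj₁ init a on
  ... | inj₂ a≡Tl = ⊥-elim (a≢Tl a≡Tl)
  ... | inj₁ refl = link-to {S 0} Hd→Tl (tl-active {S 0} w₀)
                      (<ᵛ-cong (hd-val {S 0} w₀) (tl-val {S 0} w₀) neg1<inf)
    where
      w₀ : IsState σ (S 0)
      w₀ = wf 0 (state-zero len)
      Hd→Tl : Next (S 0) Hd ≡ Tl
      Hd→Tl = proj₁ (proj₂ (proj₂ (proj₂ init)))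

  normal : ∀ t → ValidState t → Normal (S t)
  normal zero    _ = initial-normal
  normal (suc t) v = StepFacts.normal-preserved (wf t v′) (normal t v′) (effect t (state-suc⇒in-range len v))
    where v′ = state-≤ len (n≤1+n t) v

  module At {t} (v : ValidState t) = Sorted {S t} (wf t v) (normal t v)

  module Across {t} (q : ValidAction t) = StepFacts {S t} {S (suc t)} (wf t (in-range⇒state len q)) (normal t (in-range⇒state len q))

  induction-from : (P : ℕ → Set) {t : ℕ} → P t → (∀ k → t ≤ k → ValidAction k → P k → P (suc k)) →
                   ∀ {t′} → t ≤ t′ → ValidState t′ → P t′
  induction-from P Pt next {zero}   z≤n _ = Pt
  induction-from P {t} Pt next {suc t′} t≤ v with m≤n⇒m<n∨m≡n t≤
  ... | inj₂ refl     = Pt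
  ... | inj₁ (s≤s t≤t′) = next t′ t≤t′ (state-suc⇒in-range len v)
                            (induction-from P Pt next t≤t′ (state-≤ len (n≤1+n t′) v))

  active-mono : ∀ {t t′ a} → t ≤ t′ → ValidState t′ → Active (S t) a ≡ true → Active (S t′) a ≡ true
  active-mono {a = a} t≤t′ v on = induction-from (λ k → Active (S k) a ≡ true) on
    (λ k _ q on′ → Across.active-mono q (effect k q) a on′) t≤t′ v

  val-stable : ∀ {t t′ a} → t ≤ t′ → ValidState t′ → Active (S t) a ≡ true → Val (S t′) a ≡ Val (S t) a
  val-stable {t} {a = a} t≤t′ v on = proj₂ (induction-from (λ k → Active (S k) a ≡ true × Val (S k) a ≡ Val (S t) a)
    (on , refl) (λ k _ q (on′ , eq) → Across.active-mono q (effect k q) a on′ ,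
                                      trans (Across.val-stable q (effect k q) a on′) eq) t≤t′ v)

  inserted-at : ∀ {j p a} → e j ≡ adNew p a → (q : ValidAction j) → Insertion (S j) (S (suc j)) (X (S j) p) a
  inserted-at eq q = insertion (step-as q eq)

  unlinked-at : ∀ {k p d} → e k ≡ rmOk p d → (q : ValidAction k) → Unlinking (S k) (S (suc k)) (X (S k) p) d
  unlinked-at eq q = unlinking (step-as q eq)

  inserted-on-main : ∀ {j p a} → e j ≡ adNew p a → ValidAction j → OnMain σ (S (suc j)) a
  inserted-on-main {j} eq q = subst (OnMain σ (S (suc j))) next-after
      (mNext (Across.main-after q (effect j q) after-main λ _ eq′ → adNew≢rmOk (trans (sym eq) eq′))
             (At.below⇒≢Tl (in-range⇒state len q) after-below))
    where open Insertion (inserted-at eq q)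

  removed-off-main : ∀ {k p d} → e k ≡ rmOk p d → ValidAction k → ¬ OnMain σ (S (suc k)) d
  removed-off-main eq q m = proj₂ (Across.AfterUnlinking.main-before q (unlinked-at eq q) m) refl

  activation-precedes : ∀ {j t p a} → e j ≡ adNew p a → ValidAction j → ValidState t →
                        Active (S t) a ≡ true → j < t
  activation-precedes {j} {t} eq q v on with t ℕ.≤? j
  ... | no  t≰j = ℕ.≰⇒> t≰j
  ... | yes t≤j = ⊥-elim (true≢false (active-mono t≤j (in-range⇒state len q) on) (Insertion.fresh (inserted-at eq q)))

  activation-unique : ∀ {j j′ p p′ a} → e j ≡ adNew p a → e j′ ≡ adNew p′ a →
                      ValidAction j → ValidAction j′ → j ≡ j′
  activation-unique {j} {j′} eq eq′ q q′ with <-cmp j j′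
  ... | tri≈ _ j≡j′ _ = j≡j′
  ... | tri< j<j′ _ _ = ⊥-elim (<-irrefl refl (activation-precedes eq′ q′ (in-range⇒state len q′)
                          (active-mono j<j′ (in-range⇒state len q′) (Insertion.activated (inserted-at eq q)))))
  ... | tri> _ _ j′<j = ⊥-elim (<-irrefl refl (activation-precedes eq q (in-range⇒state len q)
                          (active-mono j′<j (in-range⇒state len q) (Insertion.activated (inserted-at eq′ q′)))))

  -- Allocated addresses have decidable equality (compare activation times), which is what makes
  -- a removal of a given address detectable by bounded search.
  data Allocated (t : ℕ) : Addr → Set where
    isHd        : Allocated t Hd
    isTl        : Allocated t Tl
    activatedBy : ∀ {j p x} → j < t → e j ≡ adNew p x → Allocated t x

  allocated-mono : ∀ {t t′ x} → t ≤ t′ → Allocated t x → Allocated t′ x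
  allocated-mono _    isHd                  = isHd
  allocated-mono _    isTl                  = isTl
  allocated-mono t≤t′ (activatedBy j<t eq) = activatedBy (<-≤-trans j<t t≤t′) eq

  allocated-suc : ∀ {t y} → Allocated (suc t) y → Allocated t y ⊎ Σ (Proc σ) (λ p → e t ≡ adNew p y)
  allocated-suc isHd = inj₁ isHd
  allocated-suc isTl = inj₁ isTl
  allocated-suc (activatedBy (s≤s j≤t) eq) with m≤n⇒m<n∨m≡n j≤t
  ... | inj₁ j<t  = inj₁ (activatedBy j<t eq)
  ... | inj₂ refl = inj₂ (_ , eq)

  allocated⇒active : ∀ {t x} → ValidState t → Allocated t x → Active (S t) x ≡ true
  allocated⇒active {t} v isHd = hd-active {S t} (wf t v)
  allocated⇒active {t} v isTl = tl-active {S t} (wf t v)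
  allocated⇒active v (activatedBy j<t eq) =
    active-mono j<t v (Insertion.activated (inserted-at eq (state-<⇒in-range len j<t v)))

  activated≢always-active : ∀ {j t p y z} → ValidState t → j < t → e j ≡ adNew p y →
                            (∀ k → ValidState k → Active (S k) z ≡ true) → z ≢ y
  activated≢always-active {j} v j<t eq always refl =
    true≢false (always j (state-≤ len (<⇒≤ j<t) v)) (Insertion.fresh (inserted-at eq (state-<⇒in-range len j<t v)))

  allocated-≟ : ∀ {t x y} → ValidState t → Allocated t x → Allocated t y → Dec (x ≡ y)
  allocated-≟ v isHd isHd = yes refl
  allocated-≟ v isTl isTl = yes refl
  allocated-≟ v isHd isTl = no Hd≢Tl
  allocated-≟ v isTl isHd = no λ eq → Hd≢Tl (sym eq)
  allocated-≟ v isHd (activatedBy j<t eq) = no (activated≢always-active v j<t eq λ k w → hd-active {S k} (wf k w))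
  allocated-≟ v isTl (activatedBy j<t eq) = no (activated≢always-active v j<t eq λ k w → tl-active {S k} (wf k w))
  allocated-≟ v (activatedBy j<t eq) isHd =
    no λ eq′ → activated≢always-active v j<t eq (λ k w → hd-active {S k} (wf k w)) (sym eq′)
  allocated-≟ v (activatedBy j<t eq) isTl =
    no λ eq′ → activated≢always-active v j<t eq (λ k w → tl-active {S k} (wf k w)) (sym eq′)
  allocated-≟ v (activatedBy {j} j<t eq) (activatedBy {j′} j′<t eq′) with j ℕ.≟ j′
  ... | yes refl = yes (adNew-injective (trans (sym eq) eq′))
  ... | no j≢j′  = no λ { refl → j≢j′ (activation-unique eq eq′ (state-<⇒in-range len j<t v) (state-<⇒in-range len j′<t v)) }

  allocated-next : ∀ t → ValidState t → ∀ {y} → Allocated t y → y ≢ Tl → Allocated t (Next (S t) y)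
  allocated-next-step : ∀ t → ValidAction t → ValidState t → ∀ {y} → Allocated (suc t) y → y ≢ Tl →
                        Allocated (suc t) (Next (S (suc t)) y)
  main⇒allocated : ∀ t → ValidState t → ∀ {x} → OnMain σ (S t) x → Allocated t x

  main⇒allocated t v mHd             = isHd
  main⇒allocated t v (mNext m y≢Tl) = allocated-next t v (main⇒allocated t v m) y≢Tl

  allocated-next zero    _ isHd _     = subst (Allocated 0) (sym (proj₁ (proj₂ (proj₂ (proj₂ init))))) isTl
  allocated-next zero    _ isTl Tl≢Tl = ⊥-elim (Tl≢Tl refl)
  allocated-next (suc t) v ay y≢Tl    =
    allocated-next-step t (state-suc⇒in-range len v) (state-≤ len (n≤1+n t) v) ay y≢Tl

  allocated-next-step t q v {y} ay y≢Tl with allocated-suc ay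
  ... | inj₂ (_ , eq) =
    subst (Allocated (suc t)) (sym next-new)
      (allocated-mono (n≤1+n t) (allocated-next t v (main⇒allocated t v after-main) (At.below⇒≢Tl v after-below)))
    where open Insertion (inserted-at eq q)
  ... | inj₁ ay′ = by-effect (effect t q)
    where
      old-successor : Next (S (suc t)) y ≡ Next (S t) y → Allocated (suc t) (Next (S (suc t)) y)
      old-successor eq = subst (Allocated (suc t)) (sym eq) (allocated-mono (n≤1+n t) (allocated-next t v ay′ y≢Tl))
      by-effect : HeapEffect (S t) (e t) (S (suc t)) → Allocated (suc t) (Next (S (suc t)) y)
      by-effect (unchanged (_ , _ , same-next)) = old-successor (same-next y)
      by-effect (inserted eq D) with allocated-≟ v ay′ (main⇒allocated t v after-main)
        where open Insertion D
      ... | yes refl = subst (Allocated (suc t)) (sym next-after) (activatedBy ≤-refl eq)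
        where open Insertion D
      ... | no y≢after = old-successor (next-other y y≢after (At.active≢inactive v (allocated⇒active v ay′) fresh))
        where open Insertion D
      by-effect (unlinked eq D) with allocated-≟ v ay′ (main⇒allocated t v before-main)
        where open Unlinking D
      ... | yes refl = subst (Allocated (suc t)) (sym bypass)
             (allocated-mono (n≤1+n t) (allocated-next t v (main⇒allocated t v removed-main) (At.nat⇒≢Tl v val-removed)))
        where open Unlinking D
      ... | no y≢before = old-successor (next-other y y≢before)
        where open Unlinking D

  allocated-nat⇒activated : ∀ {t x n} → ValidState t → Allocated t x → Val (S t) x ≡ nat n →
                            Σ ℕ λ j → j < t × Σ (Proc σ) λ p → e j ≡ adNew p x
  allocated-nat⇒activated v isHd                 val = ⊥-elim (At.nat⇒≢Hd v val refl)
  allocated-nat⇒activated v isTl                 val = ⊥-elim (At.nat⇒≢Tl v val refl)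
  allocated-nat⇒activated v (activatedBy j<t eq) _   = _ , j<t , _ , eq

  Garbage : ℕ → Addr → Set
  Garbage b x = Active (S b) x ≡ true × ¬ OnMain σ (S b) x

  garbage-stays-off-main : ∀ {b t x} → b ≤ t → ValidState t → Garbage b x → ¬ OnMain σ (S t) x
  garbage-stays-off-main {b} {x = x} b≤t v (on , off) =
    induction-from (λ k → ¬ OnMain σ (S k) x) off
      (λ k b≤k q off-k m → case-step k b≤k q off-k (Across.main-before q (effect k q) m)) b≤t v
    where
      case-step : ∀ k → b ≤ k → ValidAction k → ¬ OnMain σ (S k) x →
                  OnMain σ (S k) x ⊎ Σ (Proc σ) (λ p → e k ≡ adNew p x) → ⊥
      case-step k _   _ off-k (inj₁ m)        = off-k m
      case-step k b≤k q _     (inj₂ (_ , eq)) =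
        true≢false (active-mono b≤k (in-range⇒state len q) on) (Insertion.fresh (inserted-at eq q))

  garbage-persists : ∀ {t t′ x} → t ≤ t′ → ValidState t′ → Garbage t x → Garbage t′ x
  garbage-persists t≤t′ v garbage@(on , _) = active-mono t≤t′ v on , garbage-stays-off-main t≤t′ v garbage

  removal-leaves-garbage : ∀ {k p d} → e k ≡ rmOk p d → ValidAction k → Garbage (suc k) d
  removal-leaves-garbage eq q =
    active-mono (n≤1+n _) (in-range⇒state-suc len q)
      (At.main⇒active (in-range⇒state len q) (Unlinking.removed-main (unlinked-at eq q))) ,
    removed-off-main eq q

  NoNewGarbage : ℕ → ℕ → Set
  NoNewGarbage b k = ∀ y → Active (S k) y ≡ true → ¬ Garbage b y → y ≢ Tl → ¬ Garbage b (Next (S k) y)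

  successor-not-garbage : ∀ {b t} → b ≤ t → ValidState t → NoNewGarbage b t
  successor-not-garbage {b} = induction-from (NoNewGarbage b) base next
    where
      base : NoNewGarbage b b
      base y on ¬garbage y≢Tl (_ , off) = ¬garbage (on , λ my → off (mNext my y≢Tl))
      next : ∀ k → b ≤ k → ValidAction k → NoNewGarbage b k → NoNewGarbage b (suc k)
      next k b≤k q ih y on ¬garbage y≢Tl garbage = Across.successor-origin q (effect k q) y on y≢Tl λ
        { (inj₁ m) → garbage-stays-off-main b≤k v garbage m
        ; (inj₂ (inj₁ inactive)) → true≢false (active-mono b≤k v (proj₁ garbage)) inactive
        ; (inj₂ (inj₂ (on′ , _ , same))) → ih y on′ ¬garbage y≢Tl (subst (Garbage b) same garbage) }
        where v = in-range⇒state len q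

  pc-clash : ∀ {A : Set} {v w u : PCv} → v ≡ w → v ≡ u → w ≢ u → A
  pc-clash refl refl w≢w = ⊥-elim (w≢w refl)

  record LoopInvariant (p : Proc σ) (x : ℕ) (k : ℕ) : Set where
    field
      in-loop        : InLoop (PC (S k) p)
      x-fixed        : X (S k) p ≡ x
      curr-allocated : Allocated k (Curr (S k) p)
      below-at33     : PC (S k) p ≡ pc33 → Val (S k) (Curr (S k) p) <ᵛ nat x
      reached-at35   : PC (S k) p ≡ pc35 → nat x ≤ᵛ Val (S k) (Curr (S k) p)
  open LoopInvariant public

  module Traversal {p : Proc σ} {b r : ℕ} (c : CntExec σ h p b r) where
    b<r : b < r
    b<r = proj₁ c

    r-valid : ValidAction r
    r-valid = proj₁ (proj₂ c)

    action-< : ∀ {k} → k < r → ValidAction k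
    action-< k<r = in-range-≤ len (<⇒≤ k<r) r-valid

    state-≤r : ∀ {k} → k ≤ r → ValidState k
    state-≤r k≤r = state-≤ len k≤r (in-range⇒state len r-valid)

    x₀ : ℕ
    x₀ = X (S b) p

    start : PC (S (suc b)) p ≡ pc32 × X (S (suc b)) p ≡ x₀ × Curr (S (suc b)) p ≡ Hd
    start = own-locals {S b} {S (suc b)} (proj₂ (proj₂ (step-as (action-< b<r) (proj₁ (proj₂ (proj₂ c))))))

    step-at : ∀ k → b < k → k < r → InLoop (PC (S k) p) → TraversalStep (S k) (S (suc k)) p
    step-at k b<k k<r in-loop′ =
      traversal-step (e k) (step k (action-< k<r)) in-loop′ (proj₂ (proj₂ (proj₂ (proj₂ c))) k b<k k<r)

    invariant-start : LoopInvariant p x₀ (suc b)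
    invariant-start = let (pc≡ , x≡ , curr≡) = start in record
      { in-loop        = subst InLoop (sym pc≡) at32
      ; x-fixed        = x≡
      ; curr-allocated = subst (Allocated (suc b)) (sym curr≡) isHd
      ; below-at33     = λ pc≡33 → pc-clash pc≡ pc≡33 λ ()
      ; reached-at35   = λ pc≡35 → pc-clash pc≡ pc≡35 λ () }

    invariant-step : ∀ {k} → ValidAction k → LoopInvariant p x₀ k → TraversalStep (S k) (S (suc k)) p →
                     LoopInvariant p x₀ (suc k)
    invariant-step {k} q I = preserve
      where
        v = in-range⇒state len q
        same-curr-allocated : Curr (S (suc k)) p ≡ Curr (S k) p → Allocated (suc k) (Curr (S (suc k)) p)
        same-curr-allocated curr′ = subst (Allocated (suc k)) (sym curr′) (allocated-mono (n≤1+n k) (curr-allocated I))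
        same-curr-val : Curr (S (suc k)) p ≡ Curr (S k) p →
                        Val (S (suc k)) (Curr (S (suc k)) p) ≡ Val (S k) (Curr (S k) p)
        same-curr-val curr′ = trans (cong (Val (S (suc k))) curr′)
          (Across.val-stable q (effect k q) _ (allocated⇒active v (curr-allocated I)))
        preserve : TraversalStep (S k) (S (suc k)) p → LoopInvariant p x₀ (suc k)
        preserve (idle pc′ x′ curr′) = record
          { in-loop        = subst InLoop (sym pc′) (in-loop I)
          ; x-fixed        = trans x′ (x-fixed I)
          ; curr-allocated = same-curr-allocated curr′
          ; below-at33     = λ pc≡ → subst (_<ᵛ nat x₀) (sym (same-curr-val curr′)) (below-at33 I (trans (sym pc′) pc≡))
          ; reached-at35   = λ pc≡ → subst (nat x₀ ≤ᵛ_) (sym (same-curr-val curr′)) (reached-at35 I (trans (sym pc′) pc≡)) }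
        preserve (proceed _ below pc′ x′ curr′) = record
          { in-loop        = subst InLoop (sym pc′) at33
          ; x-fixed        = trans x′ (x-fixed I)
          ; curr-allocated = same-curr-allocated curr′
          ; below-at33     = λ _ → subst₂ _<ᵛ_ (sym (same-curr-val curr′)) (cong nat (x-fixed I)) below
          ; reached-at35   = λ pc≡ → pc-clash pc′ pc≡ λ () }
        preserve (stop _ reached pc′ x′ curr′) = record
          { in-loop        = subst InLoop (sym pc′) at35
          ; x-fixed        = trans x′ (x-fixed I)
          ; curr-allocated = same-curr-allocated curr′
          ; below-at33     = λ pc≡ → pc-clash pc′ pc≡ λ ()
          ; reached-at35   = λ _ → subst₂ _≤ᵛ_ (cong nat (x-fixed I)) (sym (same-curr-val curr′)) reached }
        preserve (advance at-33 pc′ x′ curr′) = record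
          { in-loop        = subst InLoop (sym pc′) at32
          ; x-fixed        = trans x′ (x-fixed I)
          ; curr-allocated = subst (Allocated (suc k)) (sym curr′) (allocated-mono (n≤1+n k)
                               (allocated-next k v (curr-allocated I) (At.below⇒≢Tl v (below-at33 I at-33))))
          ; below-at33     = λ pc≡ → pc-clash pc′ pc≡ λ ()
          ; reached-at35   = λ pc≡ → pc-clash pc′ pc≡ λ () }

    traversal-induction : (Q : ℕ → Set) → Q (suc b) →
      (∀ k → b < k → k < r → LoopInvariant p x₀ k → TraversalStep (S k) (S (suc k)) p → Q k → Q (suc k)) →
      ∀ k → b < k → k ≤ r → LoopInvariant p x₀ k × Q k
    traversal-induction Q Q-start Q-step (suc k) (s≤s b≤k) k<r with m≤n⇒m<n∨m≡n b≤k
    ... | inj₂ refl = invariant-start , Q-start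
    ... | inj₁ b<k  =
      let (I , Qk) = traversal-induction Q Q-start Q-step k b<k (<⇒≤ k<r)
          st = step-at k b<k k<r (in-loop I)
      in invariant-step (action-< k<r) I st , Q-step k b<k k<r I st Qk

    invariant-at-return : LoopInvariant p x₀ r
    invariant-at-return = proj₁ (traversal-induction (λ _ → ⊤) tt (λ _ _ _ _ _ _ → tt) r b<r ≤-refl)

    curr-not-garbage : ∀ k → b < k → k ≤ r → ¬ Garbage b (Curr (S k) p)
    curr-not-garbage k b<k k≤r =
      proj₂ (traversal-induction (λ k → ¬ Garbage b (Curr (S k) p)) at-start preserved k b<k k≤r)
      where
        at-start : ¬ Garbage b (Curr (S (suc b)) p)
        at-start = subst (λ z → ¬ Garbage b z) (sym (proj₂ (proj₂ start))) λ (_ , off) → off mHd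
        preserved : ∀ k → b < k → k < r → LoopInvariant p x₀ k → TraversalStep (S k) (S (suc k)) p →
                    ¬ Garbage b (Curr (S k) p) → ¬ Garbage b (Curr (S (suc k)) p)
        preserved k _ _ _ (idle _ _ curr′)        ok = subst (λ z → ¬ Garbage b z) (sym curr′) ok
        preserved k _ _ _ (proceed _ _ _ _ curr′) ok = subst (λ z → ¬ Garbage b z) (sym curr′) ok
        preserved k _ _ _ (stop _ _ _ _ curr′)    ok = subst (λ z → ¬ Garbage b z) (sym curr′) ok
        preserved k b<k k<r I (advance at-33 _ _ curr′) ok =
          subst (λ z → ¬ Garbage b z) (sym curr′) (successor-not-garbage (<⇒≤ b<k) v _
            (allocated⇒active v (curr-allocated I)) ok (At.below⇒≢Tl v (below-at33 I at-33)))
          where v = in-range⇒state len (action-< k<r)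

  module Persistence {i E : ℕ} {p₀ : Proc σ} {a : Addr} (eq : e i ≡ adNew p₀ a) (q : ValidAction i)
                     (i<E : i < E) (vE : ValidState E)
                     (kept : ∀ k → i < k → k < E → ∀ p → e k ≢ rmOk p a) where
    x : ℕ
    x = X (S i) p₀

    on-main : ∀ k → i < k → k ≤ E → OnMain σ (S k) a
    on-main k i<k k≤E = induction-from (λ k → k ≤ E → OnMain σ (S k) a) (λ _ → inserted-on-main eq q)
      (λ k i<k q′ ih k<E → Across.main-after q′ (effect k q′) (ih (<⇒≤ k<E)) (kept k i<k k<E)) i<k (state-≤ len k≤E vE) k≤E

    val-kept : ∀ k → i < k → ValidState k → Val (S k) a ≡ nat x
    val-kept k i<k v = trans (val-stable i<k v (Insertion.activated D)) (Insertion.val-new D)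
      where D = inserted-at eq q

    add-finds : ∀ {p a′} → e E ≡ adNew p a′ → ValidAction E → X (S E) p ≢ x
    add-finds eq′ q′ x≡ = At.gap-has-no-main-node vE after-main (on-main E i<E ≤-refl) after-below x≤successor successor≢x
                            (trans (val-kept E i<E vE) (cong nat (sym x≡)))
      where open Insertion (inserted-at eq′ q′)

    remove-finds : ∀ {p} → e E ≡ rmNo p → ValidAction E → X (S E) p ≢ x
    remove-finds eq′ q′ x≡ = proj₁ (proj₂ (step-as q′ eq′))
      (a , on-main E i<E ≤-refl , trans (val-kept E i<E vE) (cong nat (sym x≡)))

    module _ {p bb} (c : CntExec σ h p bb E) (i<bb : i < bb) (x≡ : X (S bb) p ≡ x) where
      open Traversal c

      curr-reaches : ∀ k → bb < k → k ≤ E → ¬ ¬ Reach (S k) (Curr (S k) p) a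
      curr-reaches k bb<k k≤E = proj₂ (traversal-induction (λ k → ¬ ¬ Reach (S k) (Curr (S k) p) a)
        (pure (subst (λ z → Reach (S (suc bb)) z a) (sym (proj₂ (proj₂ start)))
          (main⇒reach (on-main (suc bb) (m≤n⇒m≤1+n i<bb) b<r)))) preserved k bb<k k≤E)
        where
          preserved : ∀ k → bb < k → k < E → LoopInvariant p x₀ k → TraversalStep (S k) (S (suc k)) p →
                      ¬ ¬ Reach (S k) (Curr (S k) p) a → ¬ ¬ Reach (S (suc k)) (Curr (S (suc k)) p) a
          preserved k bb<k k<E I ts reach = reach >>= move ts
            where
              q′ = action-< k<E
              v = in-range⇒state len q′
              i<k = <-trans i<bb bb<k
              curr-active = allocated⇒active v (curr-allocated I)
              follow : ∀ {y} → Active (S k) y ≡ true → Reach (S k) y a → Curr (S (suc k)) p ≡ y →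
                       ¬ ¬ Reach (S (suc k)) (Curr (S (suc k)) p) a
              follow on R curr′ = Across.reach-preserved q′ (effect k q′) (kept k i<k k<E) on R >>= λ R′ →
                pure (subst (λ z → Reach (S (suc k)) z a) (sym curr′) R′)
              move : TraversalStep (S k) (S (suc k)) p → Reach (S k) (Curr (S k) p) a →
                     ¬ ¬ Reach (S (suc k)) (Curr (S (suc k)) p) a
              move (idle _ _ curr′)        R = follow curr-active R curr′
              move (proceed _ _ _ _ curr′) R = follow curr-active R curr′
              move (stop _ _ _ _ curr′)    R = follow curr-active R curr′
              move (advance at-33 _ _ curr′) R =
                follow (At.next-active v curr-active (At.below⇒≢Tl v below)) (reach-tail R curr≢a) curr′
                where
                  below = below-at33 I at-33
                  curr≢a : Curr (S k) p ≢ a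
                  curr≢a curr≡a = <ᵛ-irrefl (subst (_<ᵛ nat x₀) (trans (val-kept k i<k v) (cong nat (sym x≡)))
                                    (subst (λ z → Val (S k) z <ᵛ nat x₀) curr≡a below))

      contains-finds : e E ≢ retNo p
      contains-finds eq′ = curr-reaches E b<r ≤-refl λ R →
        let I = invariant-at-return
            st = step-as r-valid eq′
            curr≤a = subst (Val (S E) (Curr (S E) p) ≤ᵛ_) (val-kept E i<E vE)
                       (At.reach⇒≤ᵛ vE (allocated⇒active vE (curr-allocated I)) R)
            x≤curr = subst (λ n → nat n ≤ᵛ Val (S E) (Curr (S E) p)) x≡ (reached-at35 I (proj₁ st))
        in proj₁ (proj₂ st) (trans (≤ᵛ-antisym curr≤a x≤curr) (cong nat (sym (trans (x-fixed I) x≡))))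

module Axioms (σ : Setting) (h : History σ) where
  open Setting σ
  open History h
  open Heap σ
  open Labels σ
  open Run σ h

  record Observed (b t : ℕ) (a : Addr) (x : ℕ) : Set where
    field
      time-valid         : ValidState t
      allocated          : Allocated t a
      val-observed       : Val (S t) a ≡ nat x
      not-removed-before : ∀ k p → ValidAction k → e k ≡ rmOk p a → ¬ k < b

  main-not-removed-before : ∀ {t a} → ValidState t → OnMain σ (S t) a →
                            ∀ k p → ValidAction k → e k ≡ rmOk p a → ¬ k < t
  main-not-removed-before v m k p q eq k<t = proj₂ (garbage-persists k<t v (removal-leaves-garbage eq q)) m

  main-observed : ∀ {t a x} → ValidState t → OnMain σ (S t) a → Val (S t) a ≡ nat x → Observed t t a x
  main-observed v m val = record
    { time-valid = v ; allocated = main⇒allocated _ v m ; val-observed = val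
    ; not-removed-before = main-not-removed-before v m }

  successful-update-observed : ∀ i (q : ValidAction i) (l : Label σ) → e i ≡ l → UpdateOp l → statusOf σ l ≡ s1 →
                               Observed i i (adrOf σ l) (X (S i) (procOf σ l))
  successful-update-observed i q l eq op ok with update-status1 l op ok
  ... | inj₁ (p , a , refl) with step-as q eq
  ...   | (_ , (u , mu , u<x , _ , u⁺≡x , refl) , _) =
            main-observed v (mNext mu (At.below⇒≢Tl v u<x)) u⁺≡x
    where v = in-range⇒state len q
  successful-update-observed i q l eq op ok | inj₂ (p , d , refl) =
    main-observed (in-range⇒state len q) removed-main val-removed
    where open Unlinking (unlinked-at eq q)

  contains-observed : ∀ {p b r} (c : CntExec σ h p b r) → e r ≡ retYes p → Observed b r (Curr (S r) p) (X (S b) p)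
  contains-observed {p} {b} {r} c eq = record
    { time-valid = in-range⇒state len r-valid
    ; allocated = curr-allocated invariant-at-return
    ; val-observed = trans (proj₁ (proj₂ (step-as r-valid eq))) (cong nat (x-fixed invariant-at-return))
    ; not-removed-before = λ k _ q eq′ k<b →
        curr-not-garbage r b<r ≤-refl (garbage-persists k<b (in-range⇒state len (action-< b<r)) (removal-leaves-garbage eq′ q)) }
    where open Traversal c

  Succeeds : Ev σ h → Set
  Succeeds ev = (AddE σ h ev ⊎ RemE σ h ev ⊎ CntE σ h ev) × χE σ h ev ≡ s1

  succeeds? : ∀ ev → Dec (Succeeds ev)
  succeeds? (act i _) = successful-update? (e i)
  succeeds? (cnt _ _ r _) with statusOf σ (e r)
  ... | s1 = yes (inj₂ (inj₂ tt) , refl)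
  ... | s0 = no λ { (_ , ()) }
  ... | sf = no λ { (_ , ()) }

  Observation : Ev σ h → Set
  Observation ev = Observed (pos σ h (BeginE σ h ev)) (pos σ h (EndE σ h ev)) (adrE σ h ev) (valE σ h ev)

  observation : ∀ ev → Succeeds ev → Observation ev
  observation (act i q) (op , ok) = successful-update-observed i q (e i) refl op ok
  observation (cnt p b r c) (_ , ok) =
    contains-observed c (return-status1 (e r) (proj₁ (proj₂ (proj₂ (proj₂ c)))) ok)

  activation-of : ∀ {b t a x} → Observed b t a x → Σ ℕ λ j → j < t × Σ (Proc σ) λ p → e j ≡ adNew p a
  activation-of O = allocated-nat⇒activated time-valid allocated val-observed
    where open Observed O

  gamma : Ev σ h → Ev σ h
  gamma ev with succeeds? ev
  ... | yes ok = let (j , j<t , _) = activation-of (observation ev ok)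
                 in act j (state-<⇒in-range len j<t (Observed.time-valid (observation ev ok)))
  ... | no _   = ev  -- IsGamma constrains γ only on successful operations

  gamma-correct : IsGamma σ h gamma
  gamma-correct ev ok with succeeds? ev
  ... | yes ok′ = proj₂ (proj₂ (activation-of (observation ev ok′)))
  ... | no ¬ok  = ⊥-elim (¬ok ok)

  activation-facts : ∀ {b t a x j p} → Observed b t a x → e j ≡ adNew p a → ValidAction j → j < t × X (S j) p ≡ x
  activation-facts {a = a} {j = j} O eq q = j<t , nat-injective (values-agree)
    where
      open Observed O
      D = inserted-at eq q
      j<t = activation-precedes eq q time-valid (allocated⇒active time-valid allocated)
      values-agree = trans (sym (Insertion.val-new D))
                         (trans (sym (val-stable j<t time-valid (Insertion.activated D))) val-observed)

  end-valid : ∀ ev → ValidAction (pos σ h (EndE σ h ev))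
  end-valid (act _ q)     = q
  end-valid (cnt _ _ _ c) = proj₁ (proj₂ c)

  pos-begin-end : ∀ ev → pos σ h (BeginE σ h (EndE σ h ev)) ≡ pos σ h (EndE σ h ev)
  pos-begin-end (act _ _)     = refl
  pos-begin-end (cnt _ _ _ _) = refl

  act-cong : ∀ {i j} (q : ValidAction i) (q′ : ValidAction j) → i ≡ j → _≡_ {A = Ev σ h} (act i q) (act j q′)
  act-cong q q′ refl = cong (act _) (in-range-irrelevant len q q′)

  a0 : ∀ g → A0 (M σ h g)
  a0 g = (λ { (act i _) (ad , rm) → AD≢RM ad rm ; (cnt _ _ _ _) (() , _) }) ,
         (λ { (act _ _) (_ , ()) ; (cnt _ _ _ _) (() , _) }) ,
         (λ { (act _ _) (_ , ()) ; (cnt _ _ _ _) (() , _) }) ,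
         (λ { (act _ _) _ → tt ; (cnt _ _ _ _) () }) ,
         (λ { (act _ _) _ → tt ; (cnt _ _ _ _) () }) ,
         (λ { (act _ _) () ; (cnt _ _ _ _) _ () }) ,
         (λ { (act _ _) → tt , tt ; (cnt _ _ _ _) → tt , tt }) ,
         (λ { (act _ _) _ → refl , refl ; (cnt _ _ _ _) (inj₁ ()) ; (cnt _ _ _ _) (inj₂ ()) }) ,
         (λ { (act _ _) () ; (cnt _ _ _ c) _ → proj₁ c }) ,
         (λ { (act _ _) _ i<i → <-irrefl refl i<i ; (cnt _ _ _ _) () }) ,
         (λ { (act _ _) (act _ _) (act _ _) _ _ _ i<j j<k → <-trans i<j j<k }) ,
         λ { (act i q) (act j q′) _ _ → trichotomy q q′ (<-cmp i j) }
    where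
      trichotomy : ∀ {i j} (q : ValidAction i) (q′ : ValidAction j) → Tri (i < j) (i ≡ j) (j < i) →
                   i < j ⊎ _≡_ {A = Ev σ h} (act i q) (act j q′) ⊎ j < i
      trichotomy _ _  (tri< i<j _ _) = inj₁ i<j
      trichotomy q q′ (tri≈ _ i≡j _) = inj₂ (inj₁ (act-cong q q′ i≡j))
      trichotomy _ _  (tri> _ _ j<i) = inj₂ (inj₂ j<i)

  a1 : ∀ g → IsGamma σ h g → A1 (M σ h g)
  a1 g g-ok ev ok = facts (g ev) (g-ok ev ok)
    where
      O = observation ev ok
      open Observed O
      facts : ∀ γ → Activates σ h γ (adrE σ h ev) →
              AddE σ h γ × χE σ h γ ≡ s0 × valE σ h γ ≡ valE σ h ev × _≺E_ σ h γ (EndE σ h ev) ×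
              ¬ (Σ (Ev σ h) λ r → RemE σ h r × χE σ h r ≡ s1 × g r ≡ γ × _≺E_ σ h γ r × _≺E_ σ h r ev)
      facts (act j q) (p , eq) =
        subst (IsAD σ) (sym eq) isAdNew ,
        cong (statusOf σ) eq ,
        trans (cong (λ l → X (S j) (procOf σ l)) eq) (proj₂ (activation-facts O eq q)) ,
        subst (j <_) (sym (pos-begin-end ev)) (proj₁ (activation-facts O eq q)) ,
        no-removal
        where
          no-removal : ¬ (Σ (Ev σ h) λ r → RemE σ h r × χE σ h r ≡ s1 × g r ≡ act j q × _≺E_ σ h (act j q) r × _≺E_ σ h r ev)
          no-removal (act k qk , rm , ok′ , same-γ , _ , k<begin) with RM-status1 (e k) rm ok′
          ... | (pr , d , eqk) = not-removed-before k pr qk (trans eqk (cong (rmOk pr) d≡adr)) k<begin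
            where
              d-activation : Activates σ h (act j q) (adrOf σ (e k))
              d-activation = subst (λ γ → Activates σ h γ (adrOf σ (e k))) same-γ (g-ok (act k qk) (inj₂ (inj₁ rm) , ok′))
              d≡adr : d ≡ adrE σ h ev
              d≡adr = trans (sym (cong (adrOf σ) eqk)) (adNew-injective (trans (sym (proj₂ d-activation)) eq))

  RemovedAt : ℕ → Addr → Set
  RemovedAt k a = Σ (Proc σ) λ p → e k ≡ rmOk p a

  removedAt? : ∀ {k a} → ValidAction k → Allocated k a → Dec (RemovedAt k a)
  removedAt? {k} {a} q a-allocated with rmOk? (e k)
  ... | inj₂ not-rmOk = no λ (p , eq) → not-rmOk p a eq
  ... | inj₁ (p , d , eq)
      with allocated-≟ (in-range⇒state len q)
             (main⇒allocated k (in-range⇒state len q) (Unlinking.removed-main (unlinked-at eq q))) a-allocated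
  ...   | yes refl = yes (p , eq)
  ...   | no d≢a   = no λ (p′ , eq′) → d≢a (rmOk-injective (trans (sym eq) eq′))

  removal-between? : ∀ {i p a E} → e i ≡ adNew p a → ValidAction E →
                     Dec (Σ ℕ λ k → i < k × k < E × RemovedAt k a)
  removal-between? {i} {a = a} {E} eq qE =
    map′ (λ (f , i<f , removed) → toℕ f , i<f , toℕ<n f , removed)
         (λ (k , i<k , k<E , removed) → fromℕ< k<E ,
            subst (λ n → i < n × RemovedAt n a) (sym (toℕ-fromℕ< k<E)) (i<k , removed))
         (any? removed-at?)
    where
      removed-at? : (f : Fin E) → Dec (i < toℕ f × RemovedAt (toℕ f) a)
      removed-at? f with i ℕ.<? toℕ f
      ... | no  i≮f = no λ (i<f , _) → i≮f i<f
      ... | yes i<f = map′ (i<f ,_) proj₂ (removedAt? (in-range-≤ len (<⇒≤ (toℕ<n f)) qE) (activatedBy i<f eq))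

  Fails : Ev σ h → Set
  Fails ev = (AddE σ h ev ⊎ RemE σ h ev ⊎ CntE σ h ev) × χE σ h ev ≡ s0

  failure-needs-removal : ∀ {i p₀ a} → e i ≡ adNew p₀ a → ValidAction i → ∀ ev → Fails ev →
    i < pos σ h (BeginE σ h ev) → X (S i) p₀ ≡ valE σ h ev →
    ¬ (∀ k → i < k → k < pos σ h (EndE σ h ev) → ∀ p → e k ≢ rmOk p a)
  failure-needs-removal eq q (act t qt) (op , ok) i<t x≡ kept with update-status0 (e t) op ok
  ... | inj₁ (_ , _ , eqt) = Persistence.add-finds eq q i<t (in-range⇒state len qt) kept eqt qt
                               (trans (sym (cong (λ l → X (S t) (procOf σ l)) eqt)) (sym x≡))
  ... | inj₂ (_ , eqt)     = Persistence.remove-finds eq q i<t (in-range⇒state len qt) kept eqt qt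
                               (trans (sym (cong (λ l → X (S t) (procOf σ l)) eqt)) (sym x≡))
  failure-needs-removal eq q (cnt p b r c) (_ , ok) i<b x≡ kept =
    Persistence.contains-finds eq q (<-trans i<b (proj₁ c)) (in-range⇒state len (proj₁ (proj₂ c))) kept c i<b (sym x≡)
      (return-status0 (e r) (proj₁ (proj₂ (proj₂ (proj₂ c)))) ok)

  removal-before-failure : ∀ {i p₀ a} → e i ≡ adNew p₀ a → ValidAction i → ∀ ev → Fails ev →
    i < pos σ h (BeginE σ h ev) → X (S i) p₀ ≡ valE σ h ev →
    Σ ℕ λ k → i < k × k < pos σ h (EndE σ h ev) × RemovedAt k a
  removal-before-failure eq q ev fail i<begin x≡ with removal-between? eq (end-valid ev)
  ... | yes removal = removal
  ... | no  none    = ⊥-elim (failure-needs-removal eq q ev fail i<begin x≡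
                               λ k i<k k<E p eqk → none (k , i<k , k<E , p , eqk))

  activation-is : ∀ {i p a} → e i ≡ adNew p a → (q : ValidAction i) → ∀ γ → Activates σ h γ a →
                  _≡_ {A = Ev σ h} (act i q) γ
  activation-is eq q (act j qj) (_ , eq′) = act-cong q qj (activation-unique eq eq′ q qj)

  a2 : ∀ g → IsGamma σ h g → A2 (M σ h g)
  a2 g g-ok (act i q) ev fail add ok₀ i<begin x≡ with AD-status0 (e i) add ok₀
  ... | (p₀ , a , eq) with removal-before-failure eq q ev fail i<begin
                             (trans (sym (cong (λ l → X (S i) (procOf σ l)) eq)) x≡)
  ...   | (k , _ , k<end , p , eqk) =
    act k qk , removal , cong (statusOf σ) eqk ,
    activation-is eq q (g (act k qk))
      (subst (Activates σ h (g (act k qk))) (cong (adrOf σ) eqk) (g-ok (act k qk) (inj₂ (inj₁ removal) , cong (statusOf σ) eqk))) ,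
    subst (k <_) (sym (pos-begin-end ev)) k<end
    where
      qk = in-range-≤ len (<⇒≤ k<end) (end-valid ev)
      removal = subst (IsRM σ) (sym eqk) isRmOk

theorem4p9 : (σ : Setting) (h : History σ) →
    Σ (Ev σ h → Ev σ h) (IsGamma σ h) ×
    ((g : Ev σ h → Ev σ h) → IsGamma σ h g →
      A0 (M σ h g) × A1 (M σ h g) × A2 (M σ h g))
theorem4p9 σ h = (gamma , gamma-correct) , λ g g-ok → a0 g , a1 g g-ok , a2 g g-ok
  where open Axioms σ h
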